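{- Let $n\geq 7$ and let $X=\{X_1,X_2\}$ be a $\lambda_2$-equitable $2$-partition of $J(n,3)$ with quotient matrix $(p_{ij})$, and let $g$ be the characteristic function of $X_1$. Suppose that among the $\binom{n}{2}$ partial differences $g_{ij}$, $1\leq i<j\leq n$, exactly $t_1$ are of type 1, exactly $t_2$ are of type 2, and the remaining $\binom{n}{2}-t_1-t_2$ are identically zero. Then $$p_{12}p_{21}\,n(n-2)=24t_1(n-4)+3t_2(n-2)(n-4).$$
   Context: $J(n,3)$: vertices are the $3$-subsets of $[n]=\{1,\dots,n\}$, adjacent iff they share exactly two elements; it is $3(n-3)$-regular. An equitable $2$-partition with quotient matrix $(p_{ij})$ means each vertex of $X_i$ has exactly $p_{ij}$ neighbours in $X_j$; it is $\lambda_2$-equitable if $p_{11}-p_{21}=n-7$ (so $p_{12}+p_{21}=2n-2$). For distinct $i,j\in[n]$ the partial difference $g_{ij}$ is the function on $2$-subsets $y$ of $S_{ij}=[n]\setminus\{i,j\}$ given by $g_{ij}(y)=g(y\cup\{i\})-g(y\cup\{j\})$. Such a function $h$ on $2$-subsets of $S_{ij}$ is of type 1 if there are distinct $a,b\in S_{ij}$ with $h(x)=1$ if $a\in x,b\notin x$, $h(x)=-1$ if $a\notin x,b\in x$, $h(x)=0$ otherwise; it is of type 2 if $|S_{ij}|$ is even and there is a partition $S_{ij}=M_1\cup M_2$ with $|M_1|=|M_2|=|S_{ij}|/2$ such that $h(x)=1$ if $x\subseteq M_1$, $h(x)=-1$ if $x\subseteq M_2$, $h(x)=0$ otherwise. 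-}

module Defs where

open import Data.Nat using (ℕ; zero; suc; _∸_; _<_)
import Data.Nat.Properties as ℕP
open import Data.Bool using (Bool; true; false)
import Data.Bool.Properties as BP
open import Data.Integer using (ℤ; +_; -_; _-_)
open import Data.Fin using (Fin)
open import Data.Fin.Subset using (Subset; _∈_; _∉_; _∪_; _∩_; ∁; ⁅_⁆; ∣_∣; _⊆_)
open import Data.Fin.Subset.Properties using (_⊆?_)
open import Data.Vec using ([]; _∷_; lookup)
open import Data.List using (List; []; _∷_; map; _++_; filter; length)
open import Data.Product using (Σ; _×_; _,_; ∃)
open import Data.Sum using (_⊎_)
open import Relation.Nullary using (¬_; Dec; yes; no)
open import Relation.Nullary.Decidable using (_×-dec_; ⌊_⌋)
open import Relation.Binary.PropositionalEquality using (_≡_; _≢_)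

allSubsets : (n : ℕ) → List (Subset n)
allSubsets zero = [] ∷ []
allSubsets (suc n) = map (true ∷_) (allSubsets n) ++ map (false ∷_) (allSubsets n)

J3Vertices : (n : ℕ) → List (Subset n)
J3Vertices n = filter (λ s → ∣ s ∣ ℕP.≟ 3) (allSubsets n)

Adjacent : {n : ℕ} → Subset n → Subset n → Set
Adjacent x y = ∣ x ∩ y ∣ ≡ 2

nbrsIn : {n : ℕ} → (Subset n → Bool) → Bool → Subset n → ℕ
nbrsIn {n} g b x =
  length (filter (λ y → (∣ x ∩ y ∣ ℕP.≟ 2) ×-dec (g y BP.≟ b)) (J3Vertices n))

-- g : characteristic function of X₁ (X₁ = {g ≡ true}, X₂ = {g ≡ false}),
-- defining an equitable 2-partition of J(n,3) with quotient matrix p.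
IsEquitable2Partition : (n : ℕ) → (Subset n → Bool) → ℕ → ℕ → ℕ → ℕ → Set
IsEquitable2Partition n g p11 p12 p21 p22 =
    (∃ λ (x : Subset n) → ∣ x ∣ ≡ 3 × g x ≡ true)
  × (∃ λ (x : Subset n) → ∣ x ∣ ≡ 3 × g x ≡ false)
  × (∀ (x : Subset n) → ∣ x ∣ ≡ 3 → g x ≡ true →
        nbrsIn g true x ≡ p11 × nbrsIn g false x ≡ p12)
  × (∀ (x : Subset n) → ∣ x ∣ ≡ 3 → g x ≡ false →
        nbrsIn g true x ≡ p21 × nbrsIn g false x ≡ p22)

IsLambda2Equitable : (n : ℕ) → (Subset n → Bool) → ℕ → ℕ → ℕ → ℕ → Set
IsLambda2Equitable n g p11 p12 p21 p22 =
  IsEquitable2Partition n g p11 p12 p21 p22 × (+ p11 - + p21 ≡ + n - + 7)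

toℤ : Bool → ℤ
toℤ true = + 1
toℤ false = + 0

S : {n : ℕ} → Fin n → Fin n → Subset n
S i j = ∁ (⁅ i ⁆ ∪ ⁅ j ⁆)

TwoSubsetOf : {n : ℕ} → Fin n → Fin n → Subset n → Set
TwoSubsetOf i j y = ∣ y ∣ ≡ 2 × y ⊆ S i j

partialDiff : {n : ℕ} → (Subset n → Bool) → Fin n → Fin n → Subset n → ℤ
partialDiff g i j y = toℤ (g (y ∪ ⁅ i ⁆)) - toℤ (g (y ∪ ⁅ j ⁆))

type1Val : {n : ℕ} → Fin n → Fin n → Subset n → ℤ
type1Val a b y with lookup y a | lookup y b
... | true  | false = + 1
... | false | true  = - (+ 1)
... | _     | _     = + 0

type2Val : {n : ℕ} → Subset n → Subset n → Subset n → ℤ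
type2Val M₁ M₂ y with ⌊ y ⊆? M₁ ⌋ | ⌊ y ⊆? M₂ ⌋
... | true | _    = + 1
... | false | true = - (+ 1)
... | false | false = + 0

-- h (a function on 2-subsets of S_ij, given as a function on subsets) is of type 1
IsType1 : {n : ℕ} → Fin n → Fin n → (Subset n → ℤ) → Set
IsType1 {n} i j h = Σ (Fin n) λ a → Σ (Fin n) λ b →
  a ∈ S i j × b ∈ S i j × a ≢ b ×
  (∀ y → TwoSubsetOf i j y → h y ≡ type1Val a b y)

IsType2 : {n : ℕ} → Fin n → Fin n → (Subset n → ℤ) → Set
IsType2 {n} i j h = Σ (Subset n) λ M₁ → Σ (Subset n) λ M₂ →
  M₁ ∪ M₂ ≡ S i j × M₁ ∩ M₂ ≡ Data.Fin.Subset.⊥ ×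
  ∣ M₁ ∣ ≡ ∣ M₂ ∣ ×
  (∀ y → TwoSubsetOf i j y → h y ≡ type2Val M₁ M₂ y)

IsZeroFn : {n : ℕ} → Fin n → Fin n → (Subset n → ℤ) → Set
IsZeroFn i j h = ∀ y → TwoSubsetOf i j y → h y ≡ + 0

-- "Exactly t pairs i<j satisfy P": an injective enumeration Fin t → pairs
-- whose image is exactly the set of pairs i<j satisfying P.
ExactlyPairs : {n : ℕ} → (Fin n → Fin n → Set) → ℕ → Set
ExactlyPairs {n} P t = Σ (Fin t → Fin n × Fin n) λ f →
    (∀ k l → f k ≡ f l → k ≡ l)
  × (∀ k → Data.Fin._<_ (Data.Product.proj₁ (f k)) (Data.Product.proj₂ (f k))
         × P (Data.Product.proj₁ (f k)) (Data.Product.proj₂ (f k)))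
  × (∀ (i j : Fin n) → Data.Fin._<_ i j → P i j → ∃ λ k → f k ≡ (i , j))

-- Count the pairs (i < j, y), with y a 2-subset of [n] ∖ {i, j} and g_ij(y) ≠ 0, in two ways.
-- Such a pair is an edge {y ∪ {i}, y ∪ {j}} of J(n,3) between X₁ and X₂, and each such edge arises exactly once,
-- so their number E is |X₁| p₁₂ = |X₂| p₂₁. As |X₁| + |X₂| = C(n,3), and p₁₂ + p₂₁ = 2(n − 1) by the regularity of
-- J(n,3) and λ₂-equitability, this gives 2(n − 1) E = p₁₂ p₂₁ C(n,3). On the other hand a difference of type 1 is
-- nonzero at 2(n − 4) of the y and one of type 2 at (n − 2)(n − 4)/4, and for n ≥ 6 no difference has both types,
-- so 4E = 8(n − 4) t₁ + (n − 2)(n − 4) t₂.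

module Submission where

open import Defs
open import Data.Nat using (ℕ; _≤_; _*_; _+_; _∸_)
open import Data.Fin using (Fin; _<_)
open import Data.Fin.Subset using (Subset)
open import Data.Bool using (Bool)
open import Data.Sum using (_⊎_)
open import Relation.Binary.PropositionalEquality using (_≡_)

open import Data.Nat using (zero; suc; _≡ᵇ_; z≤n; s≤s) renaming (_<_ to _<ℕ_)
open import Data.Nat.Properties using (_≟_; _≤?_; +-identityʳ; *-identityʳ; +-assoc; +-comm; *-assoc; +-suc; *-zeroʳ;
  *-comm; *-distribˡ-+; *-distribʳ-+; suc-injective; ∸-+-assoc; n≤0⇒n≡0; ≤-trans; n≤1+n; m>n⇒m∸n≢0; *-cancelˡ-≡;
  m*n≡0⇒m≡0∨n≡0; ≰⇒>; m+[n∸m]≡n; +-cancelʳ-≡)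
open import Data.Nat.Combinatorics using (_C_; nC1≡n; nCk+nC[k+1]≡[n+1]C[k+1])
open import Data.Nat.Tactic.RingSolver using (solve-∀)
open import Data.Integer using (ℤ)
import Data.Integer as ℤ
import Data.Integer.Properties as ℤ
open import Data.Bool using (true; false; _∧_; _∨_; not; _xor_)
open import Data.Bool.Properties using (not-injective; ∧-zeroʳ; ∧-identityʳ; ∨-zeroʳ; ∨-comm; ∧-comm)
  renaming (_≟_ to _≟ᵇ_)
open import Data.Fin using (zero; suc) renaming (_≟_ to _≟ᶠ_)
open import Data.Fin.Properties using (_<?_; <-cmp; <⇒≢) renaming (suc-injective to Fin-suc-injective)
open import Data.Fin.Subset using (∣_∣; _∩_; _∪_; ∁; ⁅_⁆; ⊥; ⊤; _⊆_; _∈_; _∉_; _-_)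
open import Data.Fin.Subset.Properties using (_⊆?_; ⊆⊤; ∣⊤∣≡n; ∣⊥∣≡0; ∣⁅x⁆∣≡1; ∣∁p∣≡n∸∣p∣; p⊆q⇒∣p∣≤∣q∣;
  x∈⁅x⁆; x∈⁅y⁆⇒x≡y; drop-there; x∈p∩q⁺; x∈p∩q⁻; x∈p∪q⁺; x∈p∪q⁻; x∈∁p⇒x∉p; x∉p⇒x∈∁p; x∈p∧x≢y⇒x∈p-y;
  p⊆p∪q; q⊆p∪q; ⊆-antisym; Empty-unique; p─⊥≡p; ∩-comm; ∪-comm; ∩-identityʳ; ∪-identityʳ; ∪-inverseʳ;
  ∪-distribˡ-∩; ∩-distribˡ-∪)
open import Data.List using (List; []; _∷_; map; _++_; filter; length; allFin)
open import Data.List.Properties using (map-tabulate; length-tabulate)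
open import Data.Vec using ([]; _∷_; lookup; tail)
open import Data.Vec.Properties using (≡-dec; lookup-zipWith; lookup-replicate; []=⇒lookup; lookup⇒[]=)
open import Data.Product using (Σ; _,_; _×_; proj₁; proj₂; uncurry)
open import Data.Sum using (inj₁; inj₂; [_,_]′)
open import Data.Empty using (⊥-elim)
open import Function using (_∘_)
open import Level using (Level)
open import Relation.Nullary using (Dec; does; yes; no; ¬_)
open import Relation.Nullary.Decidable using (dec-true; dec-false; _×-dec_; ¬?)
open import Relation.Unary using (Pred; Decidable)
open import Relation.Binary.Definitions using (tri<; tri≈; tri>)
open import Relation.Binary.PropositionalEquality using (_≢_; refl; sym; trans; cong; cong₂; subst; subst₂; module ≡-Reasoning)

true≢false : true ≢ false
true≢false ()

does⇒ : {P : Set} (d : Dec P) → does d ≡ true → P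
does⇒ (yes p) _ = p

does-cong : {P Q : Set} (p? : Dec P) (q? : Dec Q) → (P → Q) → (Q → P) → does p? ≡ does q?
does-cong (yes p) q? P⇒Q _   = sym (dec-true q? (P⇒Q p))
does-cong (no ¬p) q? _   Q⇒P = sym (dec-false q? (¬p ∘ Q⇒P))

∧≡true : ∀ {a b} → (a ∧ b) ≡ true → a ≡ true × b ≡ true
∧≡true {true} {true} _ = refl , refl

𝟙 : Bool → ℕ
𝟙 true  = 1
𝟙 false = 0

𝟙-*-cong : ∀ b {x y} → (b ≡ true → x ≡ y) → 𝟙 b * x ≡ 𝟙 b * y
𝟙-*-cong true  x≡y = cong (_+ 0) (x≡y refl)
𝟙-*-cong false _   = refl

𝟙-∧ : ∀ a b → 𝟙 (a ∧ b) ≡ 𝟙 a * 𝟙 b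
𝟙-∧ true  b = sym (+-identityʳ (𝟙 b))
𝟙-∧ false b = refl

∑ : {A : Set} → List A → (A → ℕ) → ℕ
∑ []       f = 0
∑ (x ∷ xs) f = f x + ∑ xs f

syntax ∑ xs (λ x → e) = ∑[ x ∈ xs ] e

module _ {A : Set} where

  ∑-cong : (xs : List A) {f h : A → ℕ} → (∀ x → f x ≡ h x) → ∑ xs f ≡ ∑ xs h
  ∑-cong []       e = refl
  ∑-cong (x ∷ xs) e = cong₂ _+_ (e x) (∑-cong xs e)

  ∑-++ : (xs ys : List A) (f : A → ℕ) → ∑ (xs ++ ys) f ≡ ∑ xs f + ∑ ys f
  ∑-++ []       ys f = refl
  ∑-++ (x ∷ xs) ys f = trans (cong (f x +_) (∑-++ xs ys f)) (sym (+-assoc (f x) _ _))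

  ∑-distrib-+ : (xs : List A) (f h : A → ℕ) → ∑[ x ∈ xs ] (f x + h x) ≡ ∑ xs f + ∑ xs h
  ∑-distrib-+ []       f h = refl
  ∑-distrib-+ (x ∷ xs) f h = trans (cong (f x + h x +_) (∑-distrib-+ xs f h))
                                   (+-+-comm (f x) (h x) (∑ xs f) (∑ xs h))
    where +-+-comm : ∀ a b c d → a + b + (c + d) ≡ a + c + (b + d)
          +-+-comm = solve-∀

  ∑-distribˡ-* : (c : ℕ) (xs : List A) (f : A → ℕ) → ∑[ x ∈ xs ] (c * f x) ≡ c * ∑ xs f
  ∑-distribˡ-* c []       f = sym (*-zeroʳ c)
  ∑-distribˡ-* c (x ∷ xs) f = trans (cong (c * f x +_) (∑-distribˡ-* c xs f)) (sym (*-distribˡ-+ c (f x) _))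

  ∑-distribʳ-* : (c : ℕ) (xs : List A) (f : A → ℕ) → ∑[ x ∈ xs ] (f x * c) ≡ ∑ xs f * c
  ∑-distribʳ-* c xs f = trans (∑-cong xs (λ x → *-comm (f x) c)) (trans (∑-distribˡ-* c xs f) (*-comm c _))

  ∑-zero : (xs : List A) {f : A → ℕ} → (∀ x → f x ≡ 0) → ∑ xs f ≡ 0
  ∑-zero []       e = refl
  ∑-zero (x ∷ xs) e = cong₂ _+_ (e x) (∑-zero xs e)

  ∑-1≡length : (xs : List A) → ∑[ x ∈ xs ] 1 ≡ length xs
  ∑-1≡length []       = refl
  ∑-1≡length (x ∷ xs) = cong suc (∑-1≡length xs)

  ∑-filter : {ℓ : Level} {P : Pred A ℓ} (P? : Decidable P) (xs : List A) (f : A → ℕ) →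
    ∑ (filter P? xs) f ≡ ∑[ x ∈ xs ] (𝟙 (does (P? x)) * f x)
  ∑-filter P? []       f = refl
  ∑-filter P? (x ∷ xs) f with does (P? x)
  ... | true  = cong₂ _+_ (sym (+-identityʳ (f x))) (∑-filter P? xs f)
  ... | false = ∑-filter P? xs f

∑-map : {A B : Set} (φ : A → B) (xs : List A) (f : B → ℕ) → ∑ (map φ xs) f ≡ ∑ xs (f ∘ φ)
∑-map φ []       f = refl
∑-map φ (x ∷ xs) f = cong (f (φ x) +_) (∑-map φ xs f)

∑-comm : {A B : Set} (xs : List A) (ys : List B) (F : A → B → ℕ) →
  ∑[ x ∈ xs ] ∑[ y ∈ ys ] F x y ≡ ∑[ y ∈ ys ] ∑[ x ∈ xs ] F x y
∑-comm []       ys F = sym (∑-zero ys (λ _ → refl))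
∑-comm (x ∷ xs) ys F = trans (cong (∑ ys (F x) +_) (∑-comm xs ys F)) (sym (∑-distrib-+ ys (F x) _))

∑-pull₂ : {A B C : Set} (as : List A) (xs : List B) (ys : List C) (F : A → B → C → ℕ) →
  ∑[ a ∈ as ] ∑[ x ∈ xs ] ∑[ y ∈ ys ] F a x y ≡ ∑[ x ∈ xs ] ∑[ y ∈ ys ] ∑[ a ∈ as ] F a x y
∑-pull₂ as xs ys F = trans (∑-comm as xs _) (∑-cong xs (λ x → ∑-comm as ys (λ a y → F a x y)))

length-filter : {A : Set} {ℓ : Level} {P : Pred A ℓ} (P? : Decidable P) (xs : List A) →
  length (filter P? xs) ≡ ∑[ x ∈ xs ] 𝟙 (does (P? x))
length-filter P? xs = trans (sym (∑-1≡length (filter P? xs)))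
                            (trans (∑-filter P? xs (λ _ → 1)) (∑-cong xs (λ x → *-identityʳ _)))

∑-allSubsets-suc : (n : ℕ) (f : Subset (suc n) → ℕ) →
  ∑ (allSubsets (suc n)) f ≡ ∑[ z ∈ allSubsets n ] f (true ∷ z) + ∑[ z ∈ allSubsets n ] f (false ∷ z)
∑-allSubsets-suc n f = trans (∑-++ (map (true ∷_) (allSubsets n)) _ f)
                             (cong₂ _+_ (∑-map _ (allSubsets n) f) (∑-map _ (allSubsets n) f))

∑-allFin-suc : (n : ℕ) (f : Fin (suc n) → ℕ) → ∑ (allFin (suc n)) f ≡ f zero + ∑[ i ∈ allFin n ] f (suc i)
∑-allFin-suc n f = cong (f zero +_)
  (trans (cong (λ is → ∑ is f) (sym (map-tabulate (λ i → i) suc))) (∑-map suc (allFin n) f))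

infix 4 _≟ₛ_
_≟ₛ_ : {n : ℕ} → (x y : Subset n) → Dec (x ≡ y)
_≟ₛ_ = ≡-dec _≟ᵇ_

∑-δ-allFin : {n : ℕ} (i : Fin n) (h : Fin n → ℕ) → ∑[ j ∈ allFin n ] (𝟙 (does (i ≟ᶠ j)) * h j) ≡ h i
∑-δ-allFin {suc n} zero    h = trans (∑-allFin-suc n (λ j → 𝟙 (does (zero ≟ᶠ j)) * h j))
  (trans (cong (h zero + 0 +_) (∑-zero (allFin n) (λ _ → refl))) (trans (+-identityʳ _) (+-identityʳ _)))
∑-δ-allFin {suc n} (suc i) h = trans (∑-allFin-suc n (λ j → 𝟙 (does (suc i ≟ᶠ j)) * h j))
  (∑-δ-allFin i (h ∘ suc))

∑-δ-allFin-count : {n : ℕ} (i : Fin n) → ∑[ j ∈ allFin n ] 𝟙 (does (i ≟ᶠ j)) ≡ 1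
∑-δ-allFin-count {n} i = trans (∑-cong (allFin n) (λ j → sym (*-identityʳ _))) (∑-δ-allFin i (λ _ → 1))

∑-δ-allSubsets : {n : ℕ} (x : Subset n) (h : Subset n → ℕ) → ∑[ y ∈ allSubsets n ] (𝟙 (does (x ≟ₛ y)) * h y) ≡ h x
∑-δ-allSubsets {zero}  []          h = trans (+-identityʳ _) (+-identityʳ _)
∑-δ-allSubsets {suc n} (true ∷ x)  h = trans (∑-allSubsets-suc n (λ y → 𝟙 (does ((true ∷ x) ≟ₛ y)) * h y))
  (trans (cong₂ _+_ (∑-δ-allSubsets x (h ∘ (true ∷_))) (∑-zero (allSubsets n) (λ _ → refl))) (+-identityʳ _))
∑-δ-allSubsets {suc n} (false ∷ x) h = trans (∑-allSubsets-suc n (λ y → 𝟙 (does ((false ∷ x) ≟ₛ y)) * h y))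
  (cong₂ _+_ (∑-zero (allSubsets n) (λ _ → refl)) (∑-δ-allSubsets x (h ∘ (false ∷_))))

∑-δ-allSubsets-count : {n : ℕ} (x : Subset n) → ∑[ y ∈ allSubsets n ] 𝟙 (does (x ≟ₛ y)) ≡ 1
∑-δ-allSubsets-count {n} x = trans (∑-cong (allSubsets n) (λ y → sym (*-identityʳ _))) (∑-δ-allSubsets x (λ _ → 1))

module _ {n : ℕ} where

  lookup-∩ : (p q : Subset n) (k : Fin n) → lookup (p ∩ q) k ≡ (lookup p k ∧ lookup q k)
  lookup-∩ p q k = lookup-zipWith _∧_ k p q

  lookup-∪ : (p q : Subset n) (k : Fin n) → lookup (p ∪ q) k ≡ (lookup p k ∨ lookup q k)
  lookup-∪ p q k = lookup-zipWith _∨_ k p q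

  lookup-⊥ : (k : Fin n) → lookup (⊥ {n}) k ≡ false
  lookup-⊥ k = lookup-replicate k false

lookup-⁅⁆ : {n : ℕ} (i k : Fin n) → lookup ⁅ i ⁆ k ≡ does (k ≟ᶠ i)
lookup-⁅⁆ zero    zero    = refl
lookup-⁅⁆ zero    (suc k) = lookup-⊥ k
lookup-⁅⁆ (suc i) zero    = refl
lookup-⁅⁆ (suc i) (suc k) = lookup-⁅⁆ i k

module _ {n : ℕ} (z M : Subset n) where

  ⊆?-complete : (∀ k → lookup z k ≡ true → lookup M k ≡ true) → does (z ⊆? M) ≡ true
  ⊆?-complete f = dec-true (z ⊆? M) (λ {k} k∈z → lookup⇒[]= k M (f k ([]=⇒lookup k∈z)))

  ⊆?-refute : (k : Fin n) → lookup z k ≡ true → lookup M k ≡ false → does (z ⊆? M) ≡ false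
  ⊆?-refute k zk Mk = dec-false (z ⊆? M) λ z⊆M → true≢false (trans (sym ([]=⇒lookup (z⊆M (lookup⇒[]= k z zk)))) Mk)

∣p∣≡∣p∩q∣+∣p∩∁q∣ : {n : ℕ} (p q : Subset n) → ∣ p ∣ ≡ ∣ p ∩ q ∣ + ∣ p ∩ ∁ q ∣
∣p∣≡∣p∩q∣+∣p∩∁q∣ []          []          = refl
∣p∣≡∣p∩q∣+∣p∩∁q∣ (true ∷ p)  (true ∷ q)  = cong suc (∣p∣≡∣p∩q∣+∣p∩∁q∣ p q)
∣p∣≡∣p∩q∣+∣p∩∁q∣ (true ∷ p)  (false ∷ q) = trans (cong suc (∣p∣≡∣p∩q∣+∣p∩∁q∣ p q)) (sym (+-suc _ _))
∣p∣≡∣p∩q∣+∣p∩∁q∣ (false ∷ p) (_ ∷ q)     = ∣p∣≡∣p∩q∣+∣p∩∁q∣ p q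

∣p∪q∣≡∣p∣+∣q∣ : {n : ℕ} (p q : Subset n) → p ∩ q ≡ ⊥ → ∣ p ∪ q ∣ ≡ ∣ p ∣ + ∣ q ∣
∣p∪q∣≡∣p∣+∣q∣ []          []          e = refl
∣p∪q∣≡∣p∣+∣q∣ (true ∷ p)  (false ∷ q) e = cong suc (∣p∪q∣≡∣p∣+∣q∣ p q (cong tail e))
∣p∪q∣≡∣p∣+∣q∣ (false ∷ p) (true ∷ q)  e = trans (cong suc (∣p∪q∣≡∣p∣+∣q∣ p q (cong tail e))) (sym (+-suc _ _))
∣p∪q∣≡∣p∣+∣q∣ (false ∷ p) (false ∷ q) e = ∣p∪q∣≡∣p∣+∣q∣ p q (cong tail e)

∣p∣≡1⇒p≡⁅x⁆ : {n : ℕ} (p : Subset n) → ∣ p ∣ ≡ 1 → Σ (Fin n) (λ i → p ≡ ⁅ i ⁆)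
∣p∣≡1⇒p≡⁅x⁆ (true ∷ p)  e = zero , cong (true ∷_) (∣p∣≡0⇒p≡⊥ p (suc-injective e))
  where ∣p∣≡0⇒p≡⊥ : {n : ℕ} (p : Subset n) → ∣ p ∣ ≡ 0 → p ≡ ⊥
        ∣p∣≡0⇒p≡⊥ []          _ = refl
        ∣p∣≡0⇒p≡⊥ (false ∷ p) e = cong (false ∷_) (∣p∣≡0⇒p≡⊥ p e)
∣p∣≡1⇒p≡⁅x⁆ (false ∷ p) e with ∣p∣≡1⇒p≡⁅x⁆ p e
... | i , p≡⁅i⁆ = suc i , cong (false ∷_) p≡⁅i⁆

⁅x⁆∩⁅y⁆≡⊥ : {n : ℕ} {a c : Fin n} → a ≢ c → ⁅ a ⁆ ∩ ⁅ c ⁆ ≡ ⊥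
⁅x⁆∩⁅y⁆≡⊥ {a = a} {c} a≢c = Empty-unique λ (k , k∈⁅a⁆∩⁅c⁆) →
  let k∈⁅a⁆ , k∈⁅c⁆ = x∈p∩q⁻ ⁅ a ⁆ ⁅ c ⁆ k∈⁅a⁆∩⁅c⁆
  in a≢c (trans (sym (x∈⁅y⁆⇒x≡y a k∈⁅a⁆)) (x∈⁅y⁆⇒x≡y c k∈⁅c⁆))

⁅⁆-injective : {n : ℕ} {a c : Fin n} → ⁅ a ⁆ ≡ ⁅ c ⁆ → a ≡ c
⁅⁆-injective {a = a} {c} e = x∈⁅y⁆⇒x≡y c (subst (a ∈_) e (x∈⁅x⁆ a))

∣p∪⁅x⁆∣≡1+∣p∣ : {n : ℕ} {p : Subset n} {x : Fin n} → x ∉ p → ∣ p ∪ ⁅ x ⁆ ∣ ≡ suc ∣ p ∣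
∣p∪⁅x⁆∣≡1+∣p∣ {p = p} {x} x∉p =
  trans (∣p∪q∣≡∣p∣+∣q∣ p ⁅ x ⁆ p∩⁅x⁆≡⊥) (trans (cong (∣ p ∣ +_) (∣⁅x⁆∣≡1 x)) (+-comm ∣ p ∣ 1))
  where p∩⁅x⁆≡⊥ : p ∩ ⁅ x ⁆ ≡ ⊥
        p∩⁅x⁆≡⊥ = Empty-unique λ (k , k∈p∩⁅x⁆) →
          let k∈p , k∈⁅x⁆ = x∈p∩q⁻ p ⁅ x ⁆ k∈p∩⁅x⁆ in x∉p (subst (_∈ p) (x∈⁅y⁆⇒x≡y x k∈⁅x⁆) k∈p)

p≡[p∩q]∪[p∩∁q] : {n : ℕ} (p q : Subset n) → p ≡ (p ∩ q) ∪ (p ∩ ∁ q)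
p≡[p∩q]∪[p∩∁q] p q = sym (trans (sym (∩-distribˡ-∪ p q (∁ q))) (trans (cong (p ∩_) (∪-inverseʳ q)) (∩-identityʳ p)))

[p∪⁅x⁆]∩[p∪⁅y⁆]≡p : {n : ℕ} (p : Subset n) {x y : Fin n} → x ≢ y → (p ∪ ⁅ x ⁆) ∩ (p ∪ ⁅ y ⁆) ≡ p
[p∪⁅x⁆]∩[p∪⁅y⁆]≡p p {x} {y} x≢y =
  trans (sym (∪-distribˡ-∩ p ⁅ x ⁆ ⁅ y ⁆)) (trans (cong (p ∪_) (⁅x⁆∩⁅y⁆≡⊥ x≢y)) (∪-identityʳ p))

[p∪⁅x⁆]∖[p∪⁅y⁆]≡⁅x⁆ : {n : ℕ} (p : Subset n) {x y : Fin n} → x ∉ p → x ≢ y → (p ∪ ⁅ x ⁆) ∩ ∁ (p ∪ ⁅ y ⁆) ≡ ⁅ x ⁆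
[p∪⁅x⁆]∖[p∪⁅y⁆]≡⁅x⁆ p {x} {y} x∉p x≢y = ⊆-antisym ⊆⁅x⁆ ⁅x⁆⊆
  where
  ⊆⁅x⁆ : (p ∪ ⁅ x ⁆) ∩ ∁ (p ∪ ⁅ y ⁆) ⊆ ⁅ x ⁆
  ⊆⁅x⁆ k∈ with x∈p∩q⁻ (p ∪ ⁅ x ⁆) _ k∈
  ... | k∈p∪⁅x⁆ , k∈∁[p∪⁅y⁆] with x∈p∪q⁻ p ⁅ x ⁆ k∈p∪⁅x⁆
  ...   | inj₁ k∈p   = ⊥-elim (x∈∁p⇒x∉p k∈∁[p∪⁅y⁆] (x∈p∪q⁺ (inj₁ k∈p)))
  ...   | inj₂ k∈⁅x⁆ = k∈⁅x⁆
  ⁅x⁆⊆ : ⁅ x ⁆ ⊆ (p ∪ ⁅ x ⁆) ∩ ∁ (p ∪ ⁅ y ⁆)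
  ⁅x⁆⊆ k∈⁅x⁆ rewrite x∈⁅y⁆⇒x≡y x k∈⁅x⁆ =
    x∈p∩q⁺ (x∈p∪q⁺ (inj₂ (x∈⁅x⁆ x)) , x∉p⇒x∈∁p ([ x∉p , x≢y ∘ x∈⁅y⁆⇒x≡y y ]′ ∘ x∈p∪q⁻ p ⁅ y ⁆))

⊆?-minus : {n : ℕ} (z M : Subset n) (b : Fin n) → does (z ⊆? (M - b)) ≡ (does (z ⊆? M) ∧ not (lookup z b))
⊆?-minus (false ∷ z) (t ∷ M)     zero    = trans (cong (λ N → does (z ⊆? N)) (p─⊥≡p M)) (sym (∧-identityʳ _))
⊆?-minus (true ∷ z)  (t ∷ M)     zero    = sym (∧-zeroʳ _)
⊆?-minus (false ∷ z) (t ∷ M)     (suc b) = ⊆?-minus z M b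
⊆?-minus (true ∷ z)  (true ∷ M)  (suc b) = ⊆?-minus z M b
⊆?-minus (true ∷ z)  (false ∷ M) (suc b) = refl

∣p∣≡1+∣p-x∣ : {n : ℕ} (p : Subset n) (x : Fin n) → x ∈ p → ∣ p ∣ ≡ suc ∣ p - x ∣
∣p∣≡1+∣p-x∣ (true ∷ p)  zero    _   = cong suc (sym (cong ∣_∣ (p─⊥≡p p)))
∣p∣≡1+∣p-x∣ (true ∷ p)  (suc x) x∈p = cong suc (∣p∣≡1+∣p-x∣ p x (drop-there x∈p))
∣p∣≡1+∣p-x∣ (false ∷ p) (suc x) x∈p = ∣p∣≡1+∣p-x∣ p x (drop-there x∈p)

pair : {n : ℕ} → Fin n → Fin n → Subset n
pair a c = ⁅ a ⁆ ∪ ⁅ c ⁆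

lookup-pair : {n : ℕ} (a c k : Fin n) → lookup (pair a c) k ≡ (does (k ≟ᶠ a) ∨ does (k ≟ᶠ c))
lookup-pair a c k = trans (lookup-∪ ⁅ a ⁆ ⁅ c ⁆ k) (cong₂ _∨_ (lookup-⁅⁆ a k) (lookup-⁅⁆ c k))

∣pair∣≡2 : {n : ℕ} {a c : Fin n} → a ≢ c → ∣ pair a c ∣ ≡ 2
∣pair∣≡2 {a = a} {c} a≢c =
  trans (∣p∪q∣≡∣p∣+∣q∣ ⁅ a ⁆ ⁅ c ⁆ (⁅x⁆∩⁅y⁆≡⊥ a≢c)) (cong₂ _+_ (∣⁅x⁆∣≡1 a) (∣⁅x⁆∣≡1 c))

lookup-pair-fst : {n : ℕ} (a c : Fin n) → lookup (pair a c) a ≡ true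
lookup-pair-fst a c = trans (lookup-pair a c a) (cong (_∨ does (a ≟ᶠ c)) (dec-true (a ≟ᶠ a) refl))

lookup-pair-snd : {n : ℕ} (a c : Fin n) → lookup (pair a c) c ≡ true
lookup-pair-snd a c = trans (lookup-pair a c c) (trans (cong (does (c ≟ᶠ a) ∨_) (dec-true (c ≟ᶠ c) refl)) (∨-zeroʳ _))

lookup-pair-other : {n : ℕ} {a c k : Fin n} → k ≢ a → k ≢ c → lookup (pair a c) k ≡ false
lookup-pair-other {a = a} {c} {k} k≢a k≢c = trans (lookup-pair a c k) (cong₂ _∨_ (dec-false (k ≟ᶠ a) k≢a) (dec-false (k ≟ᶠ c) k≢c))

pair⊆? : {n : ℕ} (a c : Fin n) (M : Subset n) → does (pair a c ⊆? M) ≡ (lookup M a ∧ lookup M c)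
pair⊆? a c M with lookup M a in Ma | lookup M c in Mc
... | true  | true  = ⊆?-complete (pair a c) M λ k k∈ → members k (trans (sym (lookup-pair a c k)) k∈)
  where members : ∀ k → (does (k ≟ᶠ a) ∨ does (k ≟ᶠ c)) ≡ true → lookup M k ≡ true
        members k _ with k ≟ᶠ a | k ≟ᶠ c
        members k _ | yes refl | _        = Ma
        members k _ | no _     | yes refl = Mc
... | false | _     = ⊆?-refute (pair a c) M a (lookup-pair-fst a c) Ma
... | true  | false = ⊆?-refute (pair a c) M c (lookup-pair-snd a c) Mc

pair⊆ : {n : ℕ} {a c : Fin n} {M : Subset n} → lookup M a ≡ true → lookup M c ≡ true → pair a c ⊆ M
pair⊆ {a = a} {c} {M} a∈M c∈M = does⇒ (pair a c ⊆? M) (trans (pair⊆? a c M) (cong₂ _∧_ a∈M c∈M))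

∃-member : {n : ℕ} (B : Subset n) → 1 ≤ ∣ B ∣ → Σ (Fin n) (λ c → lookup B c ≡ true)
∃-member (true ∷ B)  _ = zero , refl
∃-member (false ∷ B) h with ∃-member B h
... | c , c∈B = suc c , c∈B

∃-member-≢ : {n : ℕ} (B : Subset n) → 2 ≤ ∣ B ∣ → (b : Fin n) → Σ (Fin n) (λ c → lookup B c ≡ true × c ≢ b)
∃-member-≢ (true ∷ B)  (s≤s h) zero    with ∃-member B h
... | c , c∈B = suc c , c∈B , λ ()
∃-member-≢ (true ∷ B)  _       (suc b) = zero , refl , λ ()
∃-member-≢ (false ∷ B) h       zero    with ∃-member B (≤-trans (s≤s z≤n) h)
... | c , c∈B = suc c , c∈B , λ ()
∃-member-≢ (false ∷ B) h       (suc b) with ∃-member-≢ B h b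
... | c , c∈B , c≢b = suc c , c∈B , c≢b ∘ Fin-suc-injective

x∈p⇒0<∣p∣ : {n : ℕ} {p : Subset n} {x : Fin n} → x ∈ p → 0 <ℕ ∣ p ∣
x∈p⇒0<∣p∣ {p = p} {x} x∈p =
  subst (_≤ ∣ p ∣) (∣⁅x⁆∣≡1 x) (p⊆q⇒∣p∣≤∣q∣ (λ y∈⁅x⁆ → subst (_∈ p) (sym (x∈⁅y⁆⇒x≡y x y∈⁅x⁆)) x∈p))

-- Counting subsets

#ₛ : (n : ℕ) → (Subset n → Bool) → ℕ
#ₛ n P = ∑[ z ∈ allSubsets n ] 𝟙 (P z)

syntax #ₛ n (λ z → b) = #[ z ⊆ n ∣ b ]

#ₛ-suc : (n : ℕ) (P : Subset (suc n) → Bool) → #ₛ (suc n) P ≡ #[ z ⊆ n ∣ P (true ∷ z) ] + #[ z ⊆ n ∣ P (false ∷ z) ]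
#ₛ-suc n P = ∑-allSubsets-suc n (𝟙 ∘ P)

#ₛ-none : (n : ℕ) (P : Subset n → Bool) → (∀ z → P z ≡ false) → #ₛ n P ≡ 0
#ₛ-none n P e = ∑-zero (allSubsets n) (λ z → cong 𝟙 (e z))

#-⊆-ofSize : {n : ℕ} (M : Subset n) (k : ℕ) → #[ z ⊆ n ∣ (∣ z ∣ ≡ᵇ k) ∧ does (z ⊆? M) ] ≡ ∣ M ∣ C k
#-⊆-ofSize {zero} []          zero    = refl
#-⊆-ofSize {zero} []          (suc k) = refl
#-⊆-ofSize {suc n} (true ∷ M)  zero    = trans (#ₛ-suc n _) (cong₂ _+_ (#ₛ-none n _ (λ _ → refl)) (#-⊆-ofSize M zero))
#-⊆-ofSize {suc n} (true ∷ M)  (suc k) = trans (#ₛ-suc n _) (trans (cong₂ _+_ (#-⊆-ofSize M k) (#-⊆-ofSize M (suc k)))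
                                                        (nCk+nC[k+1]≡[n+1]C[k+1] ∣ M ∣ k))
#-⊆-ofSize {suc n} (false ∷ M) k       = trans (#ₛ-suc n _) (cong₂ _+_ (#ₛ-none n _ (λ z → ∧-zeroʳ (suc ∣ z ∣ ≡ᵇ k))) (#-⊆-ofSize M k))

#-ofSize : (n k : ℕ) → #[ z ⊆ n ∣ ∣ z ∣ ≡ᵇ k ] ≡ n C k
#-ofSize n k = trans (∑-cong (allSubsets n) (λ z → cong 𝟙 (sym (everything⊆⊤ z))))
                     (trans (#-⊆-ofSize (⊤ {n}) k) (cong (_C k) (∣⊤∣≡n n)))
  where everything⊆⊤ : (z : Subset n) → ((∣ z ∣ ≡ᵇ k) ∧ does (z ⊆? ⊤)) ≡ (∣ z ∣ ≡ᵇ k)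
        everything⊆⊤ z = trans (cong ((∣ z ∣ ≡ᵇ k) ∧_) (dec-true (z ⊆? ⊤) ⊆⊤)) (∧-identityʳ _)

#-⊆-ofSize-∋ : {n : ℕ} (M : Subset n) (a : Fin n) → a ∈ M → (k : ℕ) →
  #[ z ⊆ n ∣ (∣ z ∣ ≡ᵇ suc k) ∧ (does (z ⊆? M) ∧ lookup z a) ] ≡ (∣ M ∣ ∸ 1) C k
#-⊆-ofSize-∋ {suc n} (true ∷ M) zero a∈M k = trans (#ₛ-suc n _)
  (trans (cong₂ _+_ (trans (∑-cong (allSubsets n) (λ z → cong (λ b → 𝟙 ((∣ z ∣ ≡ᵇ k) ∧ b)) (∧-identityʳ _))) (#-⊆-ofSize M k))
                    (#ₛ-none n _ (λ z → trans (cong ((∣ z ∣ ≡ᵇ suc k) ∧_) (∧-zeroʳ _)) (∧-zeroʳ _))))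
         (+-identityʳ _))
#-⊆-ofSize-∋ {suc n} (false ∷ M) (suc a) a∈M k = trans (#ₛ-suc n _)
  (cong₂ _+_ (#ₛ-none n _ (λ z → ∧-zeroʳ (∣ z ∣ ≡ᵇ k))) (#-⊆-ofSize-∋ M a (drop-there a∈M) k))
#-⊆-ofSize-∋ {suc n} (true ∷ M) (suc a) a∈M zero = trans (#ₛ-suc n _)
  (cong₂ _+_ (#ₛ-none n _ (λ z → empty∌ z a _)) (#-⊆-ofSize-∋ M a (drop-there a∈M) zero))
  where empty∌ : {n : ℕ} (z : Subset n) (a : Fin n) (b : Bool) → ((∣ z ∣ ≡ᵇ 0) ∧ (b ∧ lookup z a)) ≡ false
        empty∌ (true ∷ z)  a       b = refl
        empty∌ (false ∷ z) zero    b = trans (cong ((∣ z ∣ ≡ᵇ 0) ∧_) (∧-zeroʳ b)) (∧-zeroʳ _)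
        empty∌ (false ∷ z) (suc a) b = empty∌ z a b
#-⊆-ofSize-∋ {suc n} (true ∷ M) (suc a) a∈M (suc k) = trans (#ₛ-suc n _)
  (trans (cong₂ _+_ (#-⊆-ofSize-∋ M a (drop-there a∈M) k) (#-⊆-ofSize-∋ M a (drop-there a∈M) (suc k)))
         (pascal ∣ M ∣ (x∈p⇒0<∣p∣ (drop-there a∈M))))
  where pascal : ∀ m → 0 <ℕ m → (m ∸ 1) C k + (m ∸ 1) C suc k ≡ m C suc k
        pascal (suc r) _ = nCk+nC[k+1]≡[n+1]C[k+1] r k

#-meeting : {n : ℕ} (x : Subset n) (b c : ℕ) →
  #[ y ⊆ n ∣ (∣ x ∩ y ∣ ≡ᵇ b) ∧ (∣ ∁ x ∩ y ∣ ≡ᵇ c) ] ≡ (∣ x ∣ C b) * (∣ ∁ x ∣ C c)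
#-meeting {zero}  []         zero    zero    = refl
#-meeting {zero}  []         zero    (suc c) = refl
#-meeting {zero}  []         (suc b) c       = refl
#-meeting {suc n} (true ∷ x) zero    c       = trans (#ₛ-suc n _) (cong₂ _+_ (#ₛ-none n _ (λ _ → refl)) (#-meeting x zero c))
#-meeting {suc n} (true ∷ x) (suc b) c       = trans (#ₛ-suc n _)
  (trans (cong₂ _+_ (#-meeting x b c) (#-meeting x (suc b) c))
         (trans (sym (*-distribʳ-+ (∣ ∁ x ∣ C c) (∣ x ∣ C b) _)) (cong (_* (∣ ∁ x ∣ C c)) (nCk+nC[k+1]≡[n+1]C[k+1] ∣ x ∣ b))))
#-meeting {suc n} (false ∷ x) b      zero    = trans (#ₛ-suc n _)
  (cong₂ _+_ (#ₛ-none n _ (λ y → ∧-zeroʳ (∣ x ∩ y ∣ ≡ᵇ b))) (#-meeting x b zero))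
#-meeting {suc n} (false ∷ x) b      (suc c) = trans (#ₛ-suc n _)
  (trans (cong₂ _+_ (#-meeting x b c) (#-meeting x b (suc c)))
         (trans (sym (*-distribˡ-+ (∣ x ∣ C b) (∣ ∁ x ∣ C c) _)) (cong ((∣ x ∣ C b) *_) (nCk+nC[k+1]≡[n+1]C[k+1] ∣ ∁ x ∣ c))))

2*mC2≡m*[m∸1] : ∀ m → 2 * (m C 2) ≡ m * (m ∸ 1)
2*mC2≡m*[m∸1] zero    = refl
2*mC2≡m*[m∸1] (suc m) = begin
  2 * (suc m C 2)             ≡⟨ cong (2 *_) (sym (nCk+nC[k+1]≡[n+1]C[k+1] m 1)) ⟩
  2 * (m C 1 + m C 2)         ≡⟨ *-distribˡ-+ 2 (m C 1) (m C 2) ⟩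
  2 * (m C 1) + 2 * (m C 2)   ≡⟨ cong₂ _+_ (cong (2 *_) (nC1≡n m)) (2*mC2≡m*[m∸1] m) ⟩
  2 * m + m * (m ∸ 1)         ≡⟨ step m ⟩
  suc m * m                   ∎
  where
  open ≡-Reasoning
  step : ∀ m → 2 * m + m * (m ∸ 1) ≡ suc m * m
  step zero    = refl
  step (suc m) = solve m
    where solve : ∀ m → 2 * suc m + suc m * m ≡ suc (suc m) * suc m
          solve = solve-∀

4*[mC2+mC2]≡2m*[2m∸2] : ∀ m → 4 * (m C 2 + m C 2) ≡ (m + m) * ((m + m) ∸ 2)
4*[mC2+mC2]≡2m*[2m∸2] zero    = refl
4*[mC2+mC2]≡2m*[2m∸2] (suc m) = begin
  4 * (X + X)                                ≡⟨ regroup X ⟩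
  2 * (2 * (2 * X))                          ≡⟨ cong (λ t → 2 * (2 * t)) (2*mC2≡m*[m∸1] (suc m)) ⟩
  2 * (2 * (suc m * m))                      ≡⟨ expand m ⟩
  (suc m + suc m) * (m + m)                  ≡⟨ cong (λ t → (suc m + suc m) * (t ∸ 1)) (sym (+-suc m m)) ⟩
  (suc m + suc m) * ((suc m + suc m) ∸ 2)    ∎
  where
  open ≡-Reasoning
  X = suc m C 2
  regroup : ∀ X → 4 * (X + X) ≡ 2 * (2 * (2 * X))
  regroup = solve-∀
  expand : ∀ m → 2 * (2 * (suc m * m)) ≡ (suc m + suc m) * (m + m)
  expand = solve-∀

6*mC3≡m*[m∸1]*[m∸2] : ∀ m → 6 * (m C 3) ≡ m * (m ∸ 1) * (m ∸ 2)
6*mC3≡m*[m∸1]*[m∸2] 0 = refl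
6*mC3≡m*[m∸1]*[m∸2] 1 = refl
6*mC3≡m*[m∸1]*[m∸2] 2 = refl
6*mC3≡m*[m∸1]*[m∸2] (suc (suc (suc m))) = begin
  6 * (suc (suc (suc m)) C 3)                                  ≡⟨ cong (6 *_) (sym (nCk+nC[k+1]≡[n+1]C[k+1] (suc (suc m)) 2)) ⟩
  6 * (suc (suc m) C 2 + suc (suc m) C 3)                      ≡⟨ regroup (suc (suc m) C 2) (suc (suc m) C 3) ⟩
  3 * (2 * (suc (suc m) C 2)) + 6 * (suc (suc m) C 3)          ≡⟨ cong₂ (λ a b → 3 * a + b) (2*mC2≡m*[m∸1] (suc (suc m)))
                                                                                             (6*mC3≡m*[m∸1]*[m∸2] (suc (suc m))) ⟩
  3 * (suc (suc m) * suc m) + suc (suc m) * suc m * m          ≡⟨ expand m ⟩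
  suc (suc (suc m)) * suc (suc m) * suc m                      ∎
  where
  open ≡-Reasoning
  regroup : ∀ a b → 6 * (a + b) ≡ 3 * (2 * a) + 6 * b
  regroup = solve-∀
  expand : ∀ m → 3 * (suc (suc m) * suc m) + suc (suc m) * suc m * m ≡ suc (suc (suc m)) * suc (suc m) * suc m
  expand = solve-∀

-- Partial differences and their supports

∣S∣≡n∸2 : {n : ℕ} {i j : Fin n} → i ≢ j → ∣ S i j ∣ ≡ n ∸ 2
∣S∣≡n∸2 {n} {i} {j} i≢j = trans (∣∁p∣≡n∸∣p∣ (pair i j)) (cong (n ∸_) (∣pair∣≡2 i≢j))

∣S-x∣∸1≡n∸4 : {n : ℕ} {i j x : Fin n} → i ≢ j → x ∈ S i j → ∣ S i j - x ∣ ∸ 1 ≡ n ∸ 4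
∣S-x∣∸1≡n∸4 {n} {i} {j} {x} i≢j x∈S = begin
  ∣ S i j - x ∣ ∸ 1       ≡⟨ cong (_∸ 2) (sym (∣p∣≡1+∣p-x∣ (S i j) x x∈S)) ⟩
  ∣ S i j ∣ ∸ 2           ≡⟨ cong (_∸ 2) (∣S∣≡n∸2 i≢j) ⟩
  n ∸ 2 ∸ 2               ≡⟨ ∸-+-assoc n 2 2 ⟩
  n ∸ 4                   ∎
  where open ≡-Reasoning

S-comm : {n : ℕ} (i j : Fin n) → S i j ≡ S j i
S-comm i j = cong ∁ (∪-comm ⁅ i ⁆ ⁅ j ⁆)

i∉S : {n : ℕ} (i j : Fin n) → i ∉ S i j
i∉S i j i∈S = x∈∁p⇒x∉p i∈S (x∈p∪q⁺ (inj₁ (x∈⁅x⁆ i)))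

j∉S : {n : ℕ} (i j : Fin n) → j ∉ S i j
j∉S i j j∈S = x∈∁p⇒x∉p j∈S (x∈p∪q⁺ (inj₂ (x∈⁅x⁆ j)))

nonzero : ℤ → Bool
nonzero (ℤ.+_ zero) = false
nonzero _           = true

nonzero-type1Val : {n : ℕ} (a b : Fin n) (y : Subset n) → nonzero (type1Val a b y) ≡ (lookup y a xor lookup y b)
nonzero-type1Val a b y with lookup y a | lookup y b
... | true  | true  = refl
... | true  | false = refl
... | false | true  = refl
... | false | false = refl

nonzero-type2Val : {n : ℕ} (M₁ M₂ y : Subset n) → nonzero (type2Val M₁ M₂ y) ≡ (does (y ⊆? M₁) ∨ does (y ⊆? M₂))
nonzero-type2Val M₁ M₂ y with y ⊆? M₁ | y ⊆? M₂
... | yes _ | _     = refl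
... | no _  | yes _ = refl
... | no _  | no _  = refl

nonzero-partialDiff : {n : ℕ} (g : Subset n → Bool) (i j : Fin n) (y : Subset n) →
  nonzero (partialDiff g i j y) ≡ (g (y ∪ ⁅ i ⁆) xor g (y ∪ ⁅ j ⁆))
nonzero-partialDiff g i j y with g (y ∪ ⁅ i ⁆) | g (y ∪ ⁅ j ⁆)
... | true  | true  = refl
... | true  | false = refl
... | false | true  = refl
... | false | false = refl

∣supp∣ : {n : ℕ} → Fin n → Fin n → (Subset n → ℤ) → ℕ
∣supp∣ {n} i j h = #[ y ⊆ n ∣ (∣ y ∣ ≡ᵇ 2) ∧ (does (y ⊆? S i j) ∧ nonzero (h y)) ]

∣supp∣-cong : {n : ℕ} (i j : Fin n) {h h′ : Subset n → ℤ} →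
  (∀ y → TwoSubsetOf i j y → h y ≡ h′ y) → ∣supp∣ i j h ≡ ∣supp∣ i j h′
∣supp∣-cong {n} i j {h} {h′} h≗h′ = ∑-cong (allSubsets n) agree
  where
  agree : ∀ y → 𝟙 ((∣ y ∣ ≡ᵇ 2) ∧ (does (y ⊆? S i j) ∧ nonzero (h y)))
              ≡ 𝟙 ((∣ y ∣ ≡ᵇ 2) ∧ (does (y ⊆? S i j) ∧ nonzero (h′ y)))
  agree y with ∣ y ∣ ≡ᵇ 2 in ∣y∣≡2 | does (y ⊆? S i j) in y⊆S
  ... | true  | true  = cong (𝟙 ∘ nonzero) (h≗h′ y (does⇒ (∣ y ∣ ≟ 2) ∣y∣≡2 , does⇒ (y ⊆? S i j) y⊆S))
  ... | true  | false = refl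
  ... | false | _     = refl

∣supp∣-zero : {n : ℕ} (i j : Fin n) {h : Subset n → ℤ} → IsZeroFn i j h → ∣supp∣ i j h ≡ 0
∣supp∣-zero {n} i j h≗0 = trans (∣supp∣-cong i j h≗0)
  (#ₛ-none n _ λ y → trans (cong ((∣ y ∣ ≡ᵇ 2) ∧_) (∧-zeroʳ (does (y ⊆? S i j)))) (∧-zeroʳ _))

𝟙-xor-split : ∀ u v x y → 𝟙 (u ∧ (v ∧ (x xor y))) ≡ 𝟙 (u ∧ ((v ∧ not y) ∧ x)) + 𝟙 (u ∧ ((v ∧ not x) ∧ y))
𝟙-xor-split false v     x     y     = refl
𝟙-xor-split true  false x     y     = refl
𝟙-xor-split true  true  true  true  = refl
𝟙-xor-split true  true  true  false = refl
𝟙-xor-split true  true  false true  = refl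
𝟙-xor-split true  true  false false = refl

∣supp∣-type1 : {n : ℕ} (i j : Fin n) {h : Subset n → ℤ} → i ≢ j → IsType1 i j h → ∣supp∣ i j h ≡ 2 * (n ∸ 4)
∣supp∣-type1 {n} i j {h} i≢j (a , b , a∈S , b∈S , a≢b , h≗t₁) = begin
  ∣supp∣ i j h
    ≡⟨ trans (∣supp∣-cong i j h≗t₁) (∑-cong (allSubsets n) split) ⟩
  ∑[ y ∈ allSubsets n ] (𝟙 (contains a (S i j - b) y) + 𝟙 (contains b (S i j - a) y))
    ≡⟨ ∑-distrib-+ (allSubsets n) _ _ ⟩
  #[ y ⊆ n ∣ contains a (S i j - b) y ] + #[ y ⊆ n ∣ contains b (S i j - a) y ]
    ≡⟨ cong₂ _+_ (#-⊆-ofSize-∋ (S i j - b) a (x∈p∧x≢y⇒x∈p-y a∈S a≢b) 1)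
                 (#-⊆-ofSize-∋ (S i j - a) b (x∈p∧x≢y⇒x∈p-y b∈S (a≢b ∘ sym)) 1) ⟩
  (∣ S i j - b ∣ ∸ 1) C 1 + (∣ S i j - a ∣ ∸ 1) C 1
    ≡⟨ cong₂ _+_ (trans (nC1≡n _) (∣S-x∣∸1≡n∸4 i≢j b∈S)) (trans (nC1≡n _) (∣S-x∣∸1≡n∸4 i≢j a∈S)) ⟩
  (n ∸ 4) + (n ∸ 4)
    ≡⟨ cong ((n ∸ 4) +_) (sym (+-identityʳ _)) ⟩
  2 * (n ∸ 4) ∎
  where
  open ≡-Reasoning
  contains : Fin n → Subset n → Subset n → Bool
  contains x M y = (∣ y ∣ ≡ᵇ 2) ∧ (does (y ⊆? M) ∧ lookup y x)
  split : ∀ y → 𝟙 ((∣ y ∣ ≡ᵇ 2) ∧ (does (y ⊆? S i j) ∧ nonzero (type1Val a b y)))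
              ≡ 𝟙 (contains a (S i j - b) y) + 𝟙 (contains b (S i j - a) y)
  split y rewrite nonzero-type1Val a b y | ⊆?-minus y (S i j) b | ⊆?-minus y (S i j) a =
    𝟙-xor-split (∣ y ∣ ≡ᵇ 2) (does (y ⊆? S i j)) (lookup y a) (lookup y b)

𝟙-∨-disjoint : ∀ u s m₁ m₂ → (m₁ ≡ true → s ≡ true) → (m₂ ≡ true → s ≡ true) → (u ∧ (m₁ ∧ m₂)) ≡ false →
  𝟙 (u ∧ (s ∧ (m₁ ∨ m₂))) ≡ 𝟙 (u ∧ m₁) + 𝟙 (u ∧ m₂)
𝟙-∨-disjoint false s     m₁    m₂    _  _  _ = refl
𝟙-∨-disjoint true  s     true  true  _  _  ()
𝟙-∨-disjoint true  s     true  false s₁ _  _ rewrite s₁ refl = refl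
𝟙-∨-disjoint true  s     false true  _  s₂ _ rewrite s₂ refl = refl
𝟙-∨-disjoint true  s     false false _  _  _ = cong 𝟙 (∧-zeroʳ s)

∣M₁∣+∣M₂∣≡∣S∣ : {n : ℕ} {S′ M₁ M₂ : Subset n} → M₁ ∪ M₂ ≡ S′ → M₁ ∩ M₂ ≡ ⊥ → ∣ M₁ ∣ + ∣ M₂ ∣ ≡ ∣ S′ ∣
∣M₁∣+∣M₂∣≡∣S∣ {M₁ = M₁} {M₂} M₁∪M₂≡S M₁∩M₂≡⊥ =
  trans (sym (∣p∪q∣≡∣p∣+∣q∣ M₁ M₂ M₁∩M₂≡⊥)) (cong ∣_∣ M₁∪M₂≡S)

∣supp∣-type2 : {n : ℕ} (i j : Fin n) {h : Subset n → ℤ} → i ≢ j → IsType2 i j h → 4 * ∣supp∣ i j h ≡ (n ∸ 2) * (n ∸ 4)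
∣supp∣-type2 {n} i j {h} i≢j (M₁ , M₂ , M₁∪M₂≡S , M₁∩M₂≡⊥ , ∣M₁∣≡∣M₂∣ , h≗t₂) = begin
  4 * ∣supp∣ i j h
    ≡⟨ cong (4 *_) (trans (∣supp∣-cong i j h≗t₂) (∑-cong (allSubsets n) split)) ⟩
  4 * ∑[ y ∈ allSubsets n ] (𝟙 (pairIn M₁ y) + 𝟙 (pairIn M₂ y))
    ≡⟨ cong (4 *_) (trans (∑-distrib-+ (allSubsets n) _ _) (cong₂ _+_ (#-⊆-ofSize M₁ 2) (#-⊆-ofSize M₂ 2))) ⟩
  4 * (∣ M₁ ∣ C 2 + ∣ M₂ ∣ C 2)
    ≡⟨ cong (λ m → 4 * (∣ M₁ ∣ C 2 + m C 2)) (sym ∣M₁∣≡∣M₂∣) ⟩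
  4 * (∣ M₁ ∣ C 2 + ∣ M₁ ∣ C 2)
    ≡⟨ 4*[mC2+mC2]≡2m*[2m∸2] ∣ M₁ ∣ ⟩
  (∣ M₁ ∣ + ∣ M₁ ∣) * ((∣ M₁ ∣ + ∣ M₁ ∣) ∸ 2)
    ≡⟨ cong (λ m → m * (m ∸ 2)) ∣M₁∣+∣M₁∣≡n∸2 ⟩
  (n ∸ 2) * (n ∸ 2 ∸ 2)
    ≡⟨ cong ((n ∸ 2) *_) (∸-+-assoc n 2 2) ⟩
  (n ∸ 2) * (n ∸ 4) ∎
  where
  open ≡-Reasoning
  ∣M₁∣+∣M₁∣≡n∸2 : ∣ M₁ ∣ + ∣ M₁ ∣ ≡ n ∸ 2
  ∣M₁∣+∣M₁∣≡n∸2 =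
    trans (cong (∣ M₁ ∣ +_) ∣M₁∣≡∣M₂∣) (trans (∣M₁∣+∣M₂∣≡∣S∣ M₁∪M₂≡S M₁∩M₂≡⊥) (∣S∣≡n∸2 i≢j))
  pairIn : Subset n → Subset n → Bool
  pairIn M y = (∣ y ∣ ≡ᵇ 2) ∧ does (y ⊆? M)
  inS : ∀ {M} y → M ⊆ S i j → does (y ⊆? M) ≡ true → does (y ⊆? S i j) ≡ true
  inS {M} y M⊆S y⊆M = dec-true (y ⊆? S i j) (M⊆S ∘ does⇒ (y ⊆? M) y⊆M)
  M₁⊆S : M₁ ⊆ S i j
  M₁⊆S = subst (M₁ ⊆_) M₁∪M₂≡S (p⊆p∪q M₂)
  M₂⊆S : M₂ ⊆ S i j
  M₂⊆S = subst (M₂ ⊆_) M₁∪M₂≡S (q⊆p∪q M₁ M₂)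
  not-both : ∀ y → ((∣ y ∣ ≡ᵇ 2) ∧ (does (y ⊆? M₁) ∧ does (y ⊆? M₂))) ≡ false
  not-both y with y ⊆? M₁ | y ⊆? M₂
  ... | yes y⊆M₁ | yes y⊆M₂ = cong (λ m → (m ≡ᵇ 2) ∧ true) (n≤0⇒n≡0 (subst (∣ y ∣ ≤_) (∣⊥∣≡0 n)
                                   (p⊆q⇒∣p∣≤∣q∣ (subst (y ⊆_) M₁∩M₂≡⊥ (λ x∈y → x∈p∩q⁺ (y⊆M₁ x∈y , y⊆M₂ x∈y))))))
  ... | yes _    | no _     = ∧-zeroʳ _
  ... | no _     | _        = ∧-zeroʳ _
  split : ∀ y → 𝟙 ((∣ y ∣ ≡ᵇ 2) ∧ (does (y ⊆? S i j) ∧ nonzero (type2Val M₁ M₂ y))) ≡ 𝟙 (pairIn M₁ y) + 𝟙 (pairIn M₂ y)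
  split y rewrite nonzero-type2Val M₁ M₂ y =
    𝟙-∨-disjoint (∣ y ∣ ≡ᵇ 2) (does (y ⊆? S i j)) (does (y ⊆? M₁)) (does (y ⊆? M₂))
                 (inS y M₁⊆S) (inS y M₂⊆S) (not-both y)

-- If b ∈ A, the pair {a,b} lies in the support of type 2 but not of type 1; otherwise, for some c ∈ B
-- other than b, the pair {a,c} straddles A and B and lies in the support of type 1 but not of type 2.
type1-type2-clash : {n : ℕ} (S′ A B : Subset n) (a b : Fin n) → a ≢ b →
  lookup S′ a ≡ true → lookup S′ b ≡ true → (∀ k → lookup B k ≡ true → lookup S′ k ≡ true) →
  (∀ k → (lookup A k ∧ lookup B k) ≡ false) → 2 ≤ ∣ B ∣ → lookup A a ≡ true →
  ¬ (∀ y → ∣ y ∣ ≡ 2 → y ⊆ S′ → (lookup y a xor lookup y b) ≡ (does (y ⊆? A) ∨ does (y ⊆? B)))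
type1-type2-clash S′ A B a b a≢b a∈S b∈S B⊆S A∩B≡∅ 2≤∣B∣ a∈A agree with lookup A b in b∈A?
... | true = true≢false (sym (begin
  false                                        ≡⟨ sym (cong₂ _xor_ (lookup-pair-fst a b) (lookup-pair-snd a b)) ⟩
  lookup (pair a b) a xor lookup (pair a b) b  ≡⟨ agree (pair a b) (∣pair∣≡2 a≢b) (pair⊆ a∈S b∈S) ⟩
  does (pair a b ⊆? A) ∨ does (pair a b ⊆? B)  ≡⟨ cong (_∨ does (pair a b ⊆? B)) (trans (pair⊆? a b A) (cong₂ _∧_ a∈A b∈A?)) ⟩
  true                                         ∎))
  where open ≡-Reasoning
... | false with ∃-member-≢ B 2≤∣B∣ b
... | c , c∈B , c≢b = true≢false (begin
  true                                         ≡⟨ sym (cong₂ _xor_ (lookup-pair-fst a c) (lookup-pair-other (a≢b ∘ sym) (c≢b ∘ sym))) ⟩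
  lookup (pair a c) a xor lookup (pair a c) b  ≡⟨ agree (pair a c) (∣pair∣≡2 a≢c) (pair⊆ a∈S (B⊆S c c∈B)) ⟩
  does (pair a c ⊆? A) ∨ does (pair a c ⊆? B)  ≡⟨ cong₂ _∨_ (trans (pair⊆? a c A) (cong₂ _∧_ a∈A c∉A))
                                                            (trans (pair⊆? a c B) (cong₂ _∧_ a∉B c∈B)) ⟩
  false                                        ∎)
  where
  open ≡-Reasoning
  c∉A : lookup A c ≡ false
  c∉A = trans (sym (∧-identityʳ _)) (trans (cong (lookup A c ∧_) (sym c∈B)) (A∩B≡∅ c))
  a∉B : lookup B a ≡ false
  a∉B = trans (cong (_∧ lookup B a) (sym a∈A)) (A∩B≡∅ a)
  a≢c : a ≢ c
  a≢c refl = true≢false (trans (sym c∈B) a∉B)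

type1⇒¬type2 : {n : ℕ} → 6 ≤ n → (i j : Fin n) {h : Subset n → ℤ} → i ≢ j → IsType1 i j h → ¬ IsType2 i j h
type1⇒¬type2 {n} 6≤n i j i≢j (a , b , a∈S , b∈S , a≢b , h≗t₁) (M₁ , M₂ , M₁∪M₂≡S , M₁∩M₂≡⊥ , ∣M₁∣≡∣M₂∣ , h≗t₂)
  = whichever-half-contains-a (lookup M₁ a) refl
  where
  open ≡-Reasoning
  lookup∈ : ∀ {k} → k ∈ S i j → lookup (S i j) k ≡ true
  lookup∈ = []=⇒lookup
  S≡M₁∪M₂ : ∀ k → lookup (S i j) k ≡ (lookup M₁ k ∨ lookup M₂ k)
  S≡M₁∪M₂ k = trans (cong (λ T → lookup T k) (sym M₁∪M₂≡S)) (lookup-∪ M₁ M₂ k)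
  M₁∩M₂≡∅ : ∀ k → (lookup M₁ k ∧ lookup M₂ k) ≡ false
  M₁∩M₂≡∅ k = trans (sym (lookup-∩ M₁ M₂ k)) (trans (cong (λ T → lookup T k) M₁∩M₂≡⊥) (lookup-⊥ k))
  2≤∣M₁∣ : 2 ≤ ∣ M₁ ∣
  2≤∣M₁∣ = half≥2 ∣ M₁ ∣ 6≤n
    (trans (cong (∣ M₁ ∣ +_) ∣M₁∣≡∣M₂∣) (trans (∣M₁∣+∣M₂∣≡∣S∣ M₁∪M₂≡S M₁∩M₂≡⊥) (∣S∣≡n∸2 i≢j)))
    where half≥2 : ∀ {n} m → 6 ≤ n → m + m ≡ n ∸ 2 → 2 ≤ m
          half≥2 zero          (s≤s (s≤s (s≤s (s≤s (s≤s (s≤s z≤n)))))) ()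
          half≥2 (suc zero)    (s≤s (s≤s (s≤s (s≤s (s≤s (s≤s z≤n)))))) ()
          half≥2 (suc (suc m)) _                                        _ = s≤s (s≤s z≤n)
  agree : ∀ y → ∣ y ∣ ≡ 2 → y ⊆ S i j → (lookup y a xor lookup y b) ≡ (does (y ⊆? M₁) ∨ does (y ⊆? M₂))
  agree y ∣y∣≡2 y⊆S = begin
    lookup y a xor lookup y b             ≡⟨ sym (nonzero-type1Val a b y) ⟩
    nonzero (type1Val a b y)              ≡⟨ cong nonzero (trans (sym (h≗t₁ y (∣y∣≡2 , y⊆S))) (h≗t₂ y (∣y∣≡2 , y⊆S))) ⟩
    nonzero (type2Val M₁ M₂ y)            ≡⟨ nonzero-type2Val M₁ M₂ y ⟩
    does (y ⊆? M₁) ∨ does (y ⊆? M₂)       ∎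
  whichever-half-contains-a : ∀ s → ¬ lookup M₁ a ≡ s
  whichever-half-contains-a true a∈M₁ = type1-type2-clash (S i j) M₁ M₂ a b a≢b (lookup∈ a∈S) (lookup∈ b∈S)
    (λ k k∈M₂ → trans (S≡M₁∪M₂ k) (trans (cong (lookup M₁ k ∨_) k∈M₂) (∨-zeroʳ _)))
    M₁∩M₂≡∅ (subst (2 ≤_) ∣M₁∣≡∣M₂∣ 2≤∣M₁∣) a∈M₁ agree
  whichever-half-contains-a false a∉M₁ = type1-type2-clash (S i j) M₂ M₁ a b a≢b (lookup∈ a∈S) (lookup∈ b∈S)
    (λ k k∈M₁ → trans (S≡M₁∪M₂ k) (cong (_∨ lookup M₂ k) k∈M₁))
    (λ k → trans (∧-comm (lookup M₂ k) (lookup M₁ k)) (M₁∩M₂≡∅ k)) 2≤∣M₁∣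
    (trans (sym (cong (_∨ lookup M₂ a) a∉M₁)) (trans (sym (S≡M₁∪M₂ a)) (lookup∈ a∈S)))
    (λ y ∣y∣≡2 y⊆S → trans (agree y ∣y∣≡2 y⊆S) (∨-comm (does (y ⊆? M₁)) (does (y ⊆? M₂))))

type1⇒¬zero : {n : ℕ} → 5 ≤ n → (i j : Fin n) {h : Subset n → ℤ} → i ≢ j → IsType1 i j h → ¬ IsZeroFn i j h
type1⇒¬zero {n} 5≤n i j i≢j type₁ vanishes = m>n⇒m∸n≢0 5≤n
  (*-cancelˡ-≡ (n ∸ 4) 0 2 (trans (sym (∣supp∣-type1 i j i≢j type₁)) (∣supp∣-zero i j vanishes)))

type2⇒¬zero : {n : ℕ} → 5 ≤ n → (i j : Fin n) {h : Subset n → ℤ} → i ≢ j → IsType2 i j h → ¬ IsZeroFn i j h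
type2⇒¬zero {n} 5≤n i j i≢j type₂ vanishes = [ m>n⇒m∸n≢0 (≤-trans (s≤s (s≤s (s≤s z≤n))) 5≤n) , m>n⇒m∸n≢0 5≤n ]′
  (m*n≡0⇒m≡0∨n≡0 (n ∸ 2) (trans (sym (∣supp∣-type2 i j i≢j type₂)) (cong (4 *_) (∣supp∣-zero i j vanishes))))

∑< : (n : ℕ) → (Fin n → Fin n → ℕ) → ℕ
∑< n F = ∑[ i ∈ allFin n ] ∑[ j ∈ allFin n ] (𝟙 (does (i <? j)) * F i j)

module _ {n : ℕ} where

  ∑<-cong : {F G : Fin n → Fin n → ℕ} → (∀ i j → i < j → F i j ≡ G i j) → ∑< n F ≡ ∑< n G
  ∑<-cong F≗G = ∑-cong (allFin n) λ i → ∑-cong (allFin n) λ j → 𝟙-*-cong (does (i <? j)) (F≗G i j ∘ does⇒ (i <? j))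

  ∑<-distrib-+ : (F G : Fin n → Fin n → ℕ) → ∑< n (λ i j → F i j + G i j) ≡ ∑< n F + ∑< n G
  ∑<-distrib-+ F G = trans (∑-cong (allFin n) λ i →
      trans (∑-cong (allFin n) λ j → *-distribˡ-+ (𝟙 (does (i <? j))) (F i j) (G i j)) (∑-distrib-+ (allFin n) _ _))
    (∑-distrib-+ (allFin n) _ _)

  ∑<-distribˡ-* : (c : ℕ) (F : Fin n → Fin n → ℕ) → ∑< n (λ i j → c * F i j) ≡ c * ∑< n F
  ∑<-distribˡ-* c F = trans (∑-cong (allFin n) λ i →
      trans (∑-cong (allFin n) λ j → x*[c*y]≡c*[x*y] (𝟙 (does (i <? j))) c (F i j)) (∑-distribˡ-* c (allFin n) _))
    (∑-distribˡ-* c (allFin n) _)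
    where x*[c*y]≡c*[x*y] : ∀ x c y → x * (c * y) ≡ c * (x * y)
          x*[c*y]≡c*[x*y] = solve-∀

  ∑<-symmetrize : (F : Fin n → Fin n → ℕ) → (∀ i → F i i ≡ 0) →
    ∑< n (λ i j → F i j + F j i) ≡ ∑[ i ∈ allFin n ] ∑[ j ∈ allFin n ] F i j
  ∑<-symmetrize F Fii≡0 = begin
    ∑< n (λ i j → F i j + F j i)
      ≡⟨ ∑<-distrib-+ F (λ i j → F j i) ⟩
    ∑< n F + ∑< n (λ i j → F j i)
      ≡⟨ cong (∑< n F +_) (∑-comm (allFin n) (allFin n) (λ j i → 𝟙 (does (j <? i)) * F i j)) ⟩
    ∑< n F + ∑[ i ∈ allFin n ] ∑[ j ∈ allFin n ] (𝟙 (does (j <? i)) * F i j)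
      ≡⟨ sym (∑-distrib-+ (allFin n) _ _) ⟩
    ∑[ i ∈ allFin n ] (∑[ j ∈ allFin n ] (𝟙 (does (i <? j)) * F i j) + ∑[ j ∈ allFin n ] (𝟙 (does (j <? i)) * F i j))
      ≡⟨ ∑-cong (allFin n) (λ i → trans (sym (∑-distrib-+ (allFin n) _ _)) (∑-cong (allFin n) (trichotomy i))) ⟩
    ∑[ i ∈ allFin n ] ∑[ j ∈ allFin n ] F i j ∎
    where
    open ≡-Reasoning
    trichotomy : ∀ i j → 𝟙 (does (i <? j)) * F i j + 𝟙 (does (j <? i)) * F i j ≡ F i j
    trichotomy i j with <-cmp i j
    ... | tri< i<j _ j≮i rewrite dec-true (i <? j) i<j | dec-false (j <? i) j≮i = trans (+-identityʳ _) (+-identityʳ _)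
    ... | tri> i≮j _ j<i rewrite dec-false (i <? j) i≮j | dec-true (j <? i) j<i = +-identityʳ _
    ... | tri≈ _ refl _ rewrite Fii≡0 i = cong₂ _+_ (*-zeroʳ (𝟙 (does (i <? i)))) (*-zeroʳ (𝟙 (does (i <? i))))

multiplicity : {n t : ℕ} → (Fin t → Fin n × Fin n) → Fin n → Fin n → ℕ
multiplicity {t = t} f i j = ∑[ k ∈ allFin t ] 𝟙 (does ((proj₁ (f k) ≟ᶠ i) ×-dec (proj₂ (f k) ≟ᶠ j)))

∑<-multiplicity : {n t : ℕ} (f : Fin t → Fin n × Fin n) → (∀ k → proj₁ (f k) < proj₂ (f k)) → ∑< n (multiplicity f) ≡ t
∑<-multiplicity {n} {t} f ordered = begin
  ∑< n (multiplicity f)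
    ≡⟨ ∑-cong (allFin n) (λ i → ∑-cong (allFin n) λ j → sym (∑-distribˡ-* (𝟙 (does (i <? j))) (allFin t) (λ k → δ k i j))) ⟩
  ∑[ i ∈ allFin n ] ∑[ j ∈ allFin n ] ∑[ k ∈ allFin t ] (𝟙 (does (i <? j)) * δ k i j)
    ≡⟨ ∑-cong (allFin n) (λ i → ∑-comm (allFin n) (allFin t) _) ⟩
  ∑[ i ∈ allFin n ] ∑[ k ∈ allFin t ] ∑[ j ∈ allFin n ] (𝟙 (does (i <? j)) * δ k i j)
    ≡⟨ ∑-comm (allFin n) (allFin t) _ ⟩
  ∑[ k ∈ allFin t ] ∑[ i ∈ allFin n ] ∑[ j ∈ allFin n ] (𝟙 (does (i <? j)) * δ k i j)
    ≡⟨ ∑-cong (allFin t) counted-once ⟩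
  ∑[ k ∈ allFin t ] 1
    ≡⟨ trans (∑-1≡length (allFin t)) (length-tabulate (λ k → k)) ⟩
  t ∎
  where
  open ≡-Reasoning
  δ : Fin t → Fin n → Fin n → ℕ
  δ k i j = 𝟙 (does ((proj₁ (f k) ≟ᶠ i) ×-dec (proj₂ (f k) ≟ᶠ j)))
  counted-once : ∀ k → ∑[ i ∈ allFin n ] ∑[ j ∈ allFin n ] (𝟙 (does (i <? j)) * δ k i j) ≡ 1
  counted-once k = begin
    ∑[ i ∈ allFin n ] ∑[ j ∈ allFin n ] (𝟙 (does (i <? j)) * δ k i j)
      ≡⟨ ∑-cong (allFin n) (λ i → trans (∑-cong (allFin n) (λ j → regroup i j))
                                        (trans (∑-distribˡ-* (𝟙 (does (a ≟ᶠ i))) (allFin n) (λ j → 𝟙 (does (b ≟ᶠ j)) * 𝟙 (does (i <? j))))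
                                               (cong (𝟙 (does (a ≟ᶠ i)) *_) (∑-δ-allFin b (λ j → 𝟙 (does (i <? j))))))) ⟩
    ∑[ i ∈ allFin n ] (𝟙 (does (a ≟ᶠ i)) * 𝟙 (does (i <? b)))
      ≡⟨ ∑-δ-allFin a (λ i → 𝟙 (does (i <? b))) ⟩
    𝟙 (does (a <? b))
      ≡⟨ cong 𝟙 (dec-true (a <? b) (ordered k)) ⟩
    1 ∎
    where
    a = proj₁ (f k)
    b = proj₂ (f k)
    regroup : ∀ i j → 𝟙 (does (i <? j)) * δ k i j ≡ 𝟙 (does (a ≟ᶠ i)) * (𝟙 (does (b ≟ᶠ j)) * 𝟙 (does (i <? j)))
    regroup i j = trans (cong (𝟙 (does (i <? j)) *_) (𝟙-∧ (does (a ≟ᶠ i)) (does (b ≟ᶠ j))))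
                        (x*[y*z]≡y*[z*x] (𝟙 (does (i <? j))) (𝟙 (does (a ≟ᶠ i))) (𝟙 (does (b ≟ᶠ j))))
      where x*[y*z]≡y*[z*x] : ∀ x y z → x * (y * z) ≡ y * (z * x)
            x*[y*z]≡y*[z*x] = solve-∀

module _ {n t : ℕ} {P : Fin n → Fin n → Set} (ep : ExactlyPairs P t) where

  private
    f = proj₁ ep

  multiplicity-∈ : (i j : Fin n) → i < j → P i j → multiplicity f i j ≡ 1
  multiplicity-∈ i j i<j Pij with proj₂ (proj₂ (proj₂ ep)) i j i<j Pij
  ... | k₀ , fk₀≡ij = trans (∑-cong (allFin t) λ k →
                                     cong 𝟙 (does-cong ((proj₁ (f k) ≟ᶠ i) ×-dec (proj₂ (f k) ≟ᶠ j)) (k₀ ≟ᶠ k) (hits k) (hit k)))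
                            (∑-δ-allFin-count k₀)
    where
    hits : ∀ k → proj₁ (f k) ≡ i × proj₂ (f k) ≡ j → k₀ ≡ k
    hits k (e₁ , e₂) = proj₁ (proj₂ ep) k₀ k (trans fk₀≡ij (sym (cong₂ _,_ e₁ e₂)))
    hit : ∀ k → k₀ ≡ k → proj₁ (f k) ≡ i × proj₂ (f k) ≡ j
    hit k refl = cong proj₁ fk₀≡ij , cong proj₂ fk₀≡ij

  multiplicity-∉ : (i j : Fin n) → ¬ P i j → multiplicity f i j ≡ 0
  multiplicity-∉ i j ¬Pij = ∑-zero (allFin t) λ k →
    cong 𝟙 (dec-false ((proj₁ (f k) ≟ᶠ i) ×-dec (proj₂ (f k) ≟ᶠ j)) λ (e₁ , e₂) →
      ¬Pij (subst₂ P e₁ e₂ (proj₂ (proj₁ (proj₂ (proj₂ ep)) k))))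

  ∑<-multiplicity-≡ : ∑< n (multiplicity f) ≡ t
  ∑<-multiplicity-≡ = ∑<-multiplicity f (λ k → proj₁ (proj₁ (proj₂ (proj₂ ep)) k))

module _ {n t₁ t₂ : ℕ} (6≤n : 6 ≤ n) (h : Fin n → Fin n → Subset n → ℤ)
         (type₁-pairs : ExactlyPairs (λ i j → IsType1 i j (h i j)) t₁)
         (type₂-pairs : ExactlyPairs (λ i j → IsType2 i j (h i j)) t₂)
         (classified : ∀ i j → i < j → IsType1 i j (h i j) ⊎ IsType2 i j (h i j) ⊎ IsZeroFn i j (h i j)) where

  private
    m₁ m₂ : Fin n → Fin n → ℕ
    m₁ = multiplicity (proj₁ type₁-pairs)
    m₂ = multiplicity (proj₁ type₂-pairs)
    5≤n : 5 ≤ n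
    5≤n = ≤-trans (n≤1+n 5) 6≤n

  4*∣supp∣-classified : ∀ i j → i < j → 4 * ∣supp∣ i j (h i j) ≡ 8 * (n ∸ 4) * m₁ i j + (n ∸ 2) * (n ∸ 4) * m₂ i j
  4*∣supp∣-classified i j i<j with classified i j i<j
  ... | inj₁ type₁
    rewrite ∣supp∣-type1 i j (<⇒≢ i<j) type₁
          | multiplicity-∈ type₁-pairs i j i<j type₁
          | multiplicity-∉ type₂-pairs i j (type1⇒¬type2 6≤n i j (<⇒≢ i<j) type₁) = tally (n ∸ 4) ((n ∸ 2) * (n ∸ 4))
    where tally : ∀ a b → 4 * (2 * a) ≡ 8 * a * 1 + b * 0
          tally = solve-∀
  ... | inj₂ (inj₁ type₂)
    rewrite ∣supp∣-type2 i j (<⇒≢ i<j) type₂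
          | multiplicity-∉ type₁-pairs i j (λ type₁ → type1⇒¬type2 6≤n i j (<⇒≢ i<j) type₁ type₂)
          | multiplicity-∈ type₂-pairs i j i<j type₂ = tally (n ∸ 4) ((n ∸ 2) * (n ∸ 4))
    where tally : ∀ a b → b ≡ 8 * a * 0 + b * 1
          tally = solve-∀
  ... | inj₂ (inj₂ vanishes)
    rewrite ∣supp∣-zero i j vanishes
          | multiplicity-∉ type₁-pairs i j (λ type₁ → type1⇒¬zero 5≤n i j (<⇒≢ i<j) type₁ vanishes)
          | multiplicity-∉ type₂-pairs i j (λ type₂ → type2⇒¬zero 5≤n i j (<⇒≢ i<j) type₂ vanishes)
      = tally (n ∸ 4) ((n ∸ 2) * (n ∸ 4))
    where tally : ∀ a b → 0 ≡ 8 * a * 0 + b * 0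
          tally = solve-∀

  4*∑<-∣supp∣ : 4 * ∑< n (λ i j → ∣supp∣ i j (h i j)) ≡ 8 * (n ∸ 4) * t₁ + (n ∸ 2) * (n ∸ 4) * t₂
  4*∑<-∣supp∣ = begin
    4 * ∑< n (λ i j → ∣supp∣ i j (h i j))
      ≡⟨ sym (∑<-distribˡ-* 4 (λ i j → ∣supp∣ i j (h i j))) ⟩
    ∑< n (λ i j → 4 * ∣supp∣ i j (h i j))
      ≡⟨ ∑<-cong {n} 4*∣supp∣-classified ⟩
    ∑< n (λ i j → 8 * (n ∸ 4) * m₁ i j + (n ∸ 2) * (n ∸ 4) * m₂ i j)
      ≡⟨ ∑<-distrib-+ (λ i j → 8 * (n ∸ 4) * m₁ i j) (λ i j → (n ∸ 2) * (n ∸ 4) * m₂ i j) ⟩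
    ∑< n (λ i j → 8 * (n ∸ 4) * m₁ i j) + ∑< n (λ i j → (n ∸ 2) * (n ∸ 4) * m₂ i j)
      ≡⟨ cong₂ _+_ (trans (∑<-distribˡ-* (8 * (n ∸ 4)) m₁) (cong (8 * (n ∸ 4) *_) (∑<-multiplicity-≡ type₁-pairs)))
                   (trans (∑<-distribˡ-* ((n ∸ 2) * (n ∸ 4)) m₂) (cong ((n ∸ 2) * (n ∸ 4) *_) (∑<-multiplicity-≡ type₂-pairs))) ⟩
    8 * (n ∸ 4) * t₁ + (n ∸ 2) * (n ∸ 4) * t₂ ∎
    where open ≡-Reasoning

-- Edges of J(n,3)

Admissible : {n : ℕ} → Fin n → Fin n → Subset n → Set
Admissible i j z = TwoSubsetOf i j z × i ≢ j

admissible? : {n : ℕ} (i j : Fin n) (z : Subset n) → Dec (Admissible i j z)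
admissible? i j z = ((∣ z ∣ ≟ 2) ×-dec (z ⊆? S i j)) ×-dec ¬? (i ≟ᶠ j)

AdjacentVertices : {n : ℕ} → Subset n → Subset n → Set
AdjacentVertices x y = ∣ x ∣ ≡ 3 × ∣ y ∣ ≡ 3 × Adjacent x y

adjacent? : {n : ℕ} (x y : Subset n) → Dec (AdjacentVertices x y)
adjacent? x y = (∣ x ∣ ≟ 3) ×-dec ((∣ y ∣ ≟ 3) ×-dec (∣ x ∩ y ∣ ≟ 2))

Preimage : {n : ℕ} → Fin n → Fin n → Subset n → Subset n → Subset n → Set
Preimage i j z x y = Admissible i j z × z ∪ ⁅ i ⁆ ≡ x × z ∪ ⁅ j ⁆ ≡ y

preimage? : {n : ℕ} (i j : Fin n) (z x y : Subset n) → Dec (Preimage i j z x y)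
preimage? i j z x y = admissible? i j z ×-dec ((z ∪ ⁅ i ⁆ ≟ₛ x) ×-dec (z ∪ ⁅ j ⁆ ≟ₛ y))

admissible⇒adjacent : {n : ℕ} {i j : Fin n} {z : Subset n} → Admissible i j z → AdjacentVertices (z ∪ ⁅ i ⁆) (z ∪ ⁅ j ⁆)
admissible⇒adjacent {i = i} {j} {z} ((∣z∣≡2 , z⊆S) , i≢j) =
    trans (∣p∪⁅x⁆∣≡1+∣p∣ (i∉S i j ∘ z⊆S)) (cong suc ∣z∣≡2)
  , trans (∣p∪⁅x⁆∣≡1+∣p∣ (j∉S i j ∘ z⊆S)) (cong suc ∣z∣≡2)
  , trans (cong ∣_∣ ([p∪⁅x⁆]∩[p∪⁅y⁆]≡p z i≢j)) ∣z∣≡2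

-- An edge {x, y} determines its preimage: z = x ∩ y, {i} = x ∖ y and {j} = y ∖ x.
adjacent⇒unique-preimage : {n : ℕ} {x y : Subset n} → AdjacentVertices x y →
  Σ (Fin n) λ i₀ → Σ (Fin n) λ j₀ → ∀ i j z → (Preimage i j z x y → i₀ ≡ i × j₀ ≡ j × x ∩ y ≡ z)
                                              × (i₀ ≡ i × j₀ ≡ j × x ∩ y ≡ z → Preimage i j z x y)
adjacent⇒unique-preimage {n} {x} {y} (∣x∣≡3 , ∣y∣≡3 , ∣x∩y∣≡2) = i₀ , j₀ , λ i j z → unique i j z , exists i j z
  where
  ∣x∖y∣≡1 : ∣ x ∩ ∁ y ∣ ≡ 1
  ∣x∖y∣≡1 = suc-injective (suc-injective (trans (cong (_+ ∣ x ∩ ∁ y ∣) (sym ∣x∩y∣≡2))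
                                                (trans (sym (∣p∣≡∣p∩q∣+∣p∩∁q∣ x y)) ∣x∣≡3)))
  ∣y∖x∣≡1 : ∣ y ∩ ∁ x ∣ ≡ 1
  ∣y∖x∣≡1 = suc-injective (suc-injective (trans (cong (_+ ∣ y ∩ ∁ x ∣) (sym (trans (cong ∣_∣ (∩-comm y x)) ∣x∩y∣≡2)))
                                                (trans (sym (∣p∣≡∣p∩q∣+∣p∩∁q∣ y x)) ∣y∣≡3)))
  i₀ = proj₁ (∣p∣≡1⇒p≡⁅x⁆ (x ∩ ∁ y) ∣x∖y∣≡1)
  j₀ = proj₁ (∣p∣≡1⇒p≡⁅x⁆ (y ∩ ∁ x) ∣y∖x∣≡1)
  x∖y≡⁅i₀⁆ : x ∩ ∁ y ≡ ⁅ i₀ ⁆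
  x∖y≡⁅i₀⁆ = proj₂ (∣p∣≡1⇒p≡⁅x⁆ (x ∩ ∁ y) ∣x∖y∣≡1)
  y∖x≡⁅j₀⁆ : y ∩ ∁ x ≡ ⁅ j₀ ⁆
  y∖x≡⁅j₀⁆ = proj₂ (∣p∣≡1⇒p≡⁅x⁆ (y ∩ ∁ x) ∣y∖x∣≡1)
  i₀∈x∖y : i₀ ∈ x × i₀ ∈ ∁ y
  i₀∈x∖y = x∈p∩q⁻ x (∁ y) (subst (i₀ ∈_) (sym x∖y≡⁅i₀⁆) (x∈⁅x⁆ i₀))
  j₀∈y∖x : j₀ ∈ y × j₀ ∈ ∁ x
  j₀∈y∖x = x∈p∩q⁻ y (∁ x) (subst (j₀ ∈_) (sym y∖x≡⁅j₀⁆) (x∈⁅x⁆ j₀))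
  x≡[x∩y]∪⁅i₀⁆ : x ≡ (x ∩ y) ∪ ⁅ i₀ ⁆
  x≡[x∩y]∪⁅i₀⁆ = trans (p≡[p∩q]∪[p∩∁q] x y) (cong ((x ∩ y) ∪_) x∖y≡⁅i₀⁆)
  y≡[x∩y]∪⁅j₀⁆ : y ≡ (x ∩ y) ∪ ⁅ j₀ ⁆
  y≡[x∩y]∪⁅j₀⁆ = trans (p≡[p∩q]∪[p∩∁q] y x) (cong₂ _∪_ (∩-comm y x) y∖x≡⁅j₀⁆)
  x∩y⊆S : x ∩ y ⊆ S i₀ j₀
  x∩y⊆S {k} k∈x∩y = x∉p⇒x∈∁p ([ (λ k∈⁅i₀⁆ → x∈∁p⇒x∉p (proj₂ i₀∈x∖y) (subst (_∈ y) (x∈⁅y⁆⇒x≡y i₀ k∈⁅i₀⁆) (proj₂ k∈x,y)))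
                              , (λ k∈⁅j₀⁆ → x∈∁p⇒x∉p (proj₂ j₀∈y∖x) (subst (_∈ x) (x∈⁅y⁆⇒x≡y j₀ k∈⁅j₀⁆) (proj₁ k∈x,y))) ]′
                              ∘ x∈p∪q⁻ ⁅ i₀ ⁆ ⁅ j₀ ⁆)
    where k∈x,y = x∈p∩q⁻ x y k∈x∩y
  i₀≢j₀ : i₀ ≢ j₀
  i₀≢j₀ i₀≡j₀ = x∈∁p⇒x∉p (proj₂ j₀∈y∖x) (subst (_∈ x) i₀≡j₀ (proj₁ i₀∈x∖y))
  unique : ∀ i j z → Preimage i j z x y → i₀ ≡ i × j₀ ≡ j × x ∩ y ≡ z
  unique i j z (((_ , z⊆S) , i≢j) , z∪⁅i⁆≡x , z∪⁅j⁆≡y) =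
      ⁅⁆-injective (trans (sym x∖y≡⁅i₀⁆) (trans (cong₂ (λ a b → a ∩ ∁ b) (sym z∪⁅i⁆≡x) (sym z∪⁅j⁆≡y))
                                                ([p∪⁅x⁆]∖[p∪⁅y⁆]≡⁅x⁆ z (i∉S i j ∘ z⊆S) i≢j)))
    , ⁅⁆-injective (trans (sym y∖x≡⁅j₀⁆) (trans (cong₂ (λ a b → a ∩ ∁ b) (sym z∪⁅j⁆≡y) (sym z∪⁅i⁆≡x))
                                                ([p∪⁅x⁆]∖[p∪⁅y⁆]≡⁅x⁆ z (j∉S i j ∘ z⊆S) (i≢j ∘ sym))))
    , trans (cong₂ _∩_ (sym z∪⁅i⁆≡x) (sym z∪⁅j⁆≡y)) ([p∪⁅x⁆]∩[p∪⁅y⁆]≡p z i≢j)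
  exists : ∀ i j z → i₀ ≡ i × j₀ ≡ j × x ∩ y ≡ z → Preimage i j z x y
  exists _ _ _ (refl , refl , refl) = ((∣x∩y∣≡2 , x∩y⊆S) , i₀≢j₀) , sym x≡[x∩y]∪⁅i₀⁆ , sym y≡[x∩y]∪⁅j₀⁆

#-preimages : {n : ℕ} (x y : Subset n) →
  ∑[ i ∈ allFin n ] ∑[ j ∈ allFin n ] #[ z ⊆ n ∣ does (preimage? i j z x y) ] ≡ 𝟙 (does (adjacent? x y))
#-preimages {n} x y = count (adjacent? x y)
  where
  open ≡-Reasoning
  count : (adj? : Dec (AdjacentVertices x y)) →
    ∑[ i ∈ allFin n ] ∑[ j ∈ allFin n ] #[ z ⊆ n ∣ does (preimage? i j z x y) ] ≡ 𝟙 (does adj?)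
  count (no ¬adj) = ∑-zero (allFin n) λ i → ∑-zero (allFin n) λ j → #ₛ-none n _ λ z →
    dec-false (preimage? i j z x y) λ (adm , z∪⁅i⁆≡x , z∪⁅j⁆≡y) →
      ¬adj (subst₂ AdjacentVertices z∪⁅i⁆≡x z∪⁅j⁆≡y (admissible⇒adjacent adm))
  count (yes adj) with adjacent⇒unique-preimage adj
  ... | i₀ , j₀ , preimage⇔ = begin
    ∑[ i ∈ allFin n ] ∑[ j ∈ allFin n ] #[ z ⊆ n ∣ does (preimage? i j z x y) ]
      ≡⟨ ∑-cong (allFin n) (λ i → ∑-cong (allFin n) (fibre i)) ⟩
    ∑[ i ∈ allFin n ] ∑[ j ∈ allFin n ] (𝟙 (does (i₀ ≟ᶠ i)) * (𝟙 (does (j₀ ≟ᶠ j)) * 1))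
      ≡⟨ ∑-cong (allFin n) (λ i → trans (∑-distribˡ-* (𝟙 (does (i₀ ≟ᶠ i))) (allFin n) (λ j → 𝟙 (does (j₀ ≟ᶠ j)) * 1))
                                        (cong (𝟙 (does (i₀ ≟ᶠ i)) *_) (∑-δ-allFin j₀ (λ _ → 1)))) ⟩
    ∑[ i ∈ allFin n ] (𝟙 (does (i₀ ≟ᶠ i)) * 1)
      ≡⟨ ∑-δ-allFin i₀ (λ _ → 1) ⟩
    1 ∎
    where
    fibre : ∀ i j → #[ z ⊆ n ∣ does (preimage? i j z x y) ] ≡ 𝟙 (does (i₀ ≟ᶠ i)) * (𝟙 (does (j₀ ≟ᶠ j)) * 1)
    fibre i j = begin
      #[ z ⊆ n ∣ does (preimage? i j z x y) ]
        ≡⟨ ∑-cong (allSubsets n) (λ z → cong 𝟙 (does-cong (preimage? i j z x y) (δ? z) (proj₁ (preimage⇔ i j z)) (proj₂ (preimage⇔ i j z)))) ⟩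
      ∑[ z ∈ allSubsets n ] 𝟙 (does (δ? z))
        ≡⟨ ∑-cong (allSubsets n) (λ z → trans (𝟙-∧ (does (i₀ ≟ᶠ i)) _) (cong (𝟙 (does (i₀ ≟ᶠ i)) *_) (𝟙-∧ (does (j₀ ≟ᶠ j)) _))) ⟩
      ∑[ z ∈ allSubsets n ] (𝟙 (does (i₀ ≟ᶠ i)) * (𝟙 (does (j₀ ≟ᶠ j)) * 𝟙 (does (x ∩ y ≟ₛ z))))
        ≡⟨ ∑-distribˡ-* (𝟙 (does (i₀ ≟ᶠ i))) (allSubsets n) _ ⟩
      𝟙 (does (i₀ ≟ᶠ i)) * ∑[ z ∈ allSubsets n ] (𝟙 (does (j₀ ≟ᶠ j)) * 𝟙 (does (x ∩ y ≟ₛ z)))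
        ≡⟨ cong (𝟙 (does (i₀ ≟ᶠ i)) *_) (trans (∑-distribˡ-* (𝟙 (does (j₀ ≟ᶠ j))) (allSubsets n) _)
                                               (cong (𝟙 (does (j₀ ≟ᶠ j)) *_) (∑-δ-allSubsets-count (x ∩ y)))) ⟩
      𝟙 (does (i₀ ≟ᶠ i)) * (𝟙 (does (j₀ ≟ᶠ j)) * 1) ∎
      where δ? : ∀ z → Dec (i₀ ≡ i × j₀ ≡ j × x ∩ y ≡ z)
            δ? z = (i₀ ≟ᶠ i) ×-dec ((j₀ ≟ᶠ j) ×-dec (x ∩ y ≟ₛ z))

∑-admissible≡∑-adjacent : {n : ℕ} (F : Subset n → Subset n → Bool) →
  ∑[ i ∈ allFin n ] ∑[ j ∈ allFin n ] #[ z ⊆ n ∣ does (admissible? i j z) ∧ F (z ∪ ⁅ i ⁆) (z ∪ ⁅ j ⁆) ]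
  ≡ ∑[ x ∈ allSubsets n ] #[ y ⊆ n ∣ does (adjacent? x y) ∧ F x y ]
∑-admissible≡∑-adjacent {n} F = begin
  ∑[ i ∈ allFin n ] ∑[ j ∈ allFin n ] #[ z ⊆ n ∣ does (admissible? i j z) ∧ F (z ∪ ⁅ i ⁆) (z ∪ ⁅ j ⁆) ]
    ≡⟨ ∑-cong (allFin n) (λ i → ∑-cong (allFin n) λ j → ∑-cong (allSubsets n) (spread i j)) ⟩
  ∑[ i ∈ allFin n ] ∑[ j ∈ allFin n ] ∑[ z ∈ allSubsets n ] ∑[ x ∈ allSubsets n ] ∑[ y ∈ allSubsets n ] T i j z x y
    ≡⟨ ∑-cong (allFin n) (λ i → ∑-cong (allFin n) λ j → ∑-pull₂ (allSubsets n) (allSubsets n) (allSubsets n) (T i j)) ⟩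
  ∑[ i ∈ allFin n ] ∑[ j ∈ allFin n ] ∑[ x ∈ allSubsets n ] ∑[ y ∈ allSubsets n ] ∑[ z ∈ allSubsets n ] T i j z x y
    ≡⟨ ∑-cong (allFin n) (λ i → ∑-pull₂ (allFin n) (allSubsets n) (allSubsets n) (λ j x y → ∑[ z ∈ allSubsets n ] T i j z x y)) ⟩
  ∑[ i ∈ allFin n ] ∑[ x ∈ allSubsets n ] ∑[ y ∈ allSubsets n ] ∑[ j ∈ allFin n ] ∑[ z ∈ allSubsets n ] T i j z x y
    ≡⟨ ∑-pull₂ (allFin n) (allSubsets n) (allSubsets n) (λ i x y → ∑[ j ∈ allFin n ] ∑[ z ∈ allSubsets n ] T i j z x y) ⟩
  ∑[ x ∈ allSubsets n ] ∑[ y ∈ allSubsets n ] ∑[ i ∈ allFin n ] ∑[ j ∈ allFin n ] ∑[ z ∈ allSubsets n ] T i j z x y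
    ≡⟨ ∑-cong (allSubsets n) (λ x → ∑-cong (allSubsets n) (collapse x)) ⟩
  ∑[ x ∈ allSubsets n ] #[ y ⊆ n ∣ does (adjacent? x y) ∧ F x y ] ∎
  where
  open ≡-Reasoning
  T : Fin n → Fin n → Subset n → Subset n → Subset n → ℕ
  T i j z x y = 𝟙 (does (preimage? i j z x y)) * 𝟙 (F x y)
  spread : ∀ i j z → 𝟙 (does (admissible? i j z) ∧ F (z ∪ ⁅ i ⁆) (z ∪ ⁅ j ⁆))
                     ≡ ∑[ x ∈ allSubsets n ] ∑[ y ∈ allSubsets n ] T i j z x y
  spread i j z = sym (begin
    ∑[ x ∈ allSubsets n ] ∑[ y ∈ allSubsets n ] T i j z x y
      ≡⟨ ∑-cong (allSubsets n) (λ x → ∑-cong (allSubsets n) λ y → regroup x y) ⟩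
    ∑[ x ∈ allSubsets n ] ∑[ y ∈ allSubsets n ] (a * (δᵢ x * (δⱼ y * 𝟙 (F x y))))
      ≡⟨ ∑-cong (allSubsets n) (λ x → trans (∑-distribˡ-* a (allSubsets n) _)
           (cong (a *_) (trans (∑-distribˡ-* (δᵢ x) (allSubsets n) _) (cong (δᵢ x *_) (∑-δ-allSubsets (z ∪ ⁅ j ⁆) (𝟙 ∘ F x)))))) ⟩
    ∑[ x ∈ allSubsets n ] (a * (δᵢ x * 𝟙 (F x (z ∪ ⁅ j ⁆))))
      ≡⟨ trans (∑-distribˡ-* a (allSubsets n) _) (cong (a *_) (∑-δ-allSubsets (z ∪ ⁅ i ⁆) (λ x → 𝟙 (F x (z ∪ ⁅ j ⁆))))) ⟩
    a * 𝟙 (F (z ∪ ⁅ i ⁆) (z ∪ ⁅ j ⁆))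
      ≡⟨ sym (𝟙-∧ (does (admissible? i j z)) _) ⟩
    𝟙 (does (admissible? i j z) ∧ F (z ∪ ⁅ i ⁆) (z ∪ ⁅ j ⁆)) ∎)
    where
    a = 𝟙 (does (admissible? i j z))
    δᵢ δⱼ : Subset n → ℕ
    δᵢ x = 𝟙 (does (z ∪ ⁅ i ⁆ ≟ₛ x))
    δⱼ y = 𝟙 (does (z ∪ ⁅ j ⁆ ≟ₛ y))
    regroup : ∀ x y → T i j z x y ≡ a * (δᵢ x * (δⱼ y * 𝟙 (F x y)))
    regroup x y = trans (cong (_* 𝟙 (F x y)) (trans (𝟙-∧ (does (admissible? i j z)) _) (cong (a *_) (𝟙-∧ (does (z ∪ ⁅ i ⁆ ≟ₛ x)) _))))
                        (trans (*-assoc a _ _) (cong (a *_) (*-assoc (δᵢ x) _ _)))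
  collapse : ∀ x y → ∑[ i ∈ allFin n ] ∑[ j ∈ allFin n ] ∑[ z ∈ allSubsets n ] T i j z x y ≡ 𝟙 (does (adjacent? x y) ∧ F x y)
  collapse x y = begin
    ∑[ i ∈ allFin n ] ∑[ j ∈ allFin n ] ∑[ z ∈ allSubsets n ] T i j z x y
      ≡⟨ ∑-cong (allFin n) (λ i → trans (∑-cong (allFin n) λ j → ∑-distribʳ-* (𝟙 (F x y)) (allSubsets n) _)
                                        (∑-distribʳ-* (𝟙 (F x y)) (allFin n) _)) ⟩
    ∑[ i ∈ allFin n ] (∑[ j ∈ allFin n ] #[ z ⊆ n ∣ does (preimage? i j z x y) ] * 𝟙 (F x y))
      ≡⟨ ∑-distribʳ-* (𝟙 (F x y)) (allFin n) _ ⟩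
    ∑[ i ∈ allFin n ] ∑[ j ∈ allFin n ] #[ z ⊆ n ∣ does (preimage? i j z x y) ] * 𝟙 (F x y)
      ≡⟨ cong (_* 𝟙 (F x y)) (#-preimages x y) ⟩
    𝟙 (does (adjacent? x y)) * 𝟙 (F x y)
      ≡⟨ sym (𝟙-∧ (does (adjacent? x y)) (F x y)) ⟩
    𝟙 (does (adjacent? x y) ∧ F x y) ∎

flips : {n : ℕ} → (Subset n → Bool) → Fin n → Fin n → ℕ
flips {n} g i j = #[ z ⊆ n ∣ does (admissible? i j z) ∧ (g (z ∪ ⁅ i ⁆) ∧ not (g (z ∪ ⁅ j ⁆))) ]

flips-diag : {n : ℕ} (g : Subset n → Bool) (i : Fin n) → flips g i i ≡ 0
flips-diag {n} g i = #ₛ-none n _ λ z → cong (_∧ (g (z ∪ ⁅ i ⁆) ∧ not (g (z ∪ ⁅ i ⁆)))) (dec-false (admissible? i i z) λ (_ , i≢i) → i≢i refl)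

∣supp∣-partialDiff : {n : ℕ} (g : Subset n → Bool) {i j : Fin n} → i ≢ j →
  ∣supp∣ i j (partialDiff g i j) ≡ flips g i j + flips g j i
∣supp∣-partialDiff {n} g {i} {j} i≢j = trans (∑-cong (allSubsets n) split) (∑-distrib-+ (allSubsets n) _ _)
  where
  𝟙-xor : ∀ u s a b → 𝟙 (u ∧ (s ∧ (a xor b))) ≡ 𝟙 (((u ∧ s) ∧ true) ∧ (a ∧ not b)) + 𝟙 (((u ∧ s) ∧ true) ∧ (b ∧ not a))
  𝟙-xor false s     a     b     = refl
  𝟙-xor true  false a     b     = refl
  𝟙-xor true  true  true  true  = refl
  𝟙-xor true  true  true  false = refl
  𝟙-xor true  true  false true  = refl
  𝟙-xor true  true  false false = refl
  split : ∀ z → 𝟙 ((∣ z ∣ ≡ᵇ 2) ∧ (does (z ⊆? S i j) ∧ nonzero (partialDiff g i j z)))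
              ≡ 𝟙 (does (admissible? i j z) ∧ (g (z ∪ ⁅ i ⁆) ∧ not (g (z ∪ ⁅ j ⁆))))
                + 𝟙 (does (admissible? j i z) ∧ (g (z ∪ ⁅ j ⁆) ∧ not (g (z ∪ ⁅ i ⁆))))
  split z rewrite nonzero-partialDiff g i j z | dec-false (i ≟ᶠ j) i≢j | dec-false (j ≟ᶠ i) (i≢j ∘ sym) | S-comm j i =
    𝟙-xor (∣ z ∣ ≡ᵇ 2) (does (z ⊆? S i j)) (g (z ∪ ⁅ i ⁆)) (g (z ∪ ⁅ j ⁆))

nbrsIn≡# : {n : ℕ} (g : Subset n → Bool) (b : Bool) (x : Subset n) →
  nbrsIn g b x ≡ #[ y ⊆ n ∣ (∣ y ∣ ≡ᵇ 3) ∧ ((∣ x ∩ y ∣ ≡ᵇ 2) ∧ does (g y ≟ᵇ b)) ]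
nbrsIn≡# {n} g b x = trans (length-filter _ (J3Vertices n))
  (trans (∑-filter _ (allSubsets n) _) (∑-cong (allSubsets n) λ y → sym (𝟙-∧ (∣ y ∣ ≡ᵇ 3) _)))

J3-regular : {n : ℕ} (g : Subset n → Bool) (x : Subset n) → ∣ x ∣ ≡ 3 → nbrsIn g true x + nbrsIn g false x ≡ 3 * (n ∸ 3)
J3-regular {n} g x ∣x∣≡3 = begin
  nbrsIn g true x + nbrsIn g false x
    ≡⟨ cong₂ _+_ (nbrsIn≡# g true x) (nbrsIn≡# g false x) ⟩
  #[ y ⊆ n ∣ (∣ y ∣ ≡ᵇ 3) ∧ ((∣ x ∩ y ∣ ≡ᵇ 2) ∧ does (g y ≟ᵇ true)) ]
    + #[ y ⊆ n ∣ (∣ y ∣ ≡ᵇ 3) ∧ ((∣ x ∩ y ∣ ≡ᵇ 2) ∧ does (g y ≟ᵇ false)) ]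
    ≡⟨ sym (∑-distrib-+ (allSubsets n) _ _) ⟩
  ∑[ y ∈ allSubsets n ] (𝟙 ((∣ y ∣ ≡ᵇ 3) ∧ ((∣ x ∩ y ∣ ≡ᵇ 2) ∧ does (g y ≟ᵇ true)))
                        + 𝟙 ((∣ y ∣ ≡ᵇ 3) ∧ ((∣ x ∩ y ∣ ≡ᵇ 2) ∧ does (g y ≟ᵇ false))))
    ≡⟨ ∑-cong (allSubsets n) (λ y → trans (either-colour (g y) (∣ y ∣ ≡ᵇ 3) (∣ x ∩ y ∣ ≡ᵇ 2)) (cong 𝟙 (meets-x-twice y))) ⟩
  #[ y ⊆ n ∣ (∣ x ∩ y ∣ ≡ᵇ 2) ∧ (∣ ∁ x ∩ y ∣ ≡ᵇ 1) ]
    ≡⟨ #-meeting x 2 1 ⟩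
  (∣ x ∣ C 2) * (∣ ∁ x ∣ C 1)
    ≡⟨ cong₂ (λ m m′ → (m C 2) * (m′ C 1)) ∣x∣≡3 (trans (∣∁p∣≡n∸∣p∣ x) (cong (n ∸_) ∣x∣≡3)) ⟩
  (3 C 2) * ((n ∸ 3) C 1)
    ≡⟨ cong (3 *_) (nC1≡n (n ∸ 3)) ⟩
  3 * (n ∸ 3) ∎
  where
  open ≡-Reasoning
  either-colour : ∀ c u v → 𝟙 (u ∧ (v ∧ does (c ≟ᵇ true))) + 𝟙 (u ∧ (v ∧ does (c ≟ᵇ false))) ≡ 𝟙 (u ∧ v)
  either-colour true  u v = trans (cong₂ _+_ (cong (λ w → 𝟙 (u ∧ w)) (∧-identityʳ v)) (cong (λ w → 𝟙 (u ∧ w)) (∧-zeroʳ v)))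
                                  (trans (cong (𝟙 (u ∧ v) +_) (cong 𝟙 (∧-zeroʳ u))) (+-identityʳ _))
  either-colour false u v = trans (cong₂ _+_ (cong (λ w → 𝟙 (u ∧ w)) (∧-zeroʳ v)) (cong (λ w → 𝟙 (u ∧ w)) (∧-identityʳ v)))
                                  (cong (_+ 𝟙 (u ∧ v)) (cong 𝟙 (∧-zeroʳ u)))
  size-3-meeting-2 : ∀ a c → (((a + c) ≡ᵇ 3) ∧ (a ≡ᵇ 2)) ≡ ((a ≡ᵇ 2) ∧ (c ≡ᵇ 1))
  size-3-meeting-2 0             c = ∧-zeroʳ _
  size-3-meeting-2 1             c = ∧-zeroʳ _
  size-3-meeting-2 2             c = ∧-identityʳ _
  size-3-meeting-2 (suc (suc (suc a))) c = ∧-zeroʳ _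
  meets-x-twice : ∀ y → ((∣ y ∣ ≡ᵇ 3) ∧ (∣ x ∩ y ∣ ≡ᵇ 2)) ≡ ((∣ x ∩ y ∣ ≡ᵇ 2) ∧ (∣ ∁ x ∩ y ∣ ≡ᵇ 1))
  meets-x-twice y = trans (cong (λ m → (m ≡ᵇ 3) ∧ (∣ x ∩ y ∣ ≡ᵇ 2))
                               (trans (∣p∣≡∣p∩q∣+∣p∩∁q∣ y x) (cong₂ _+_ (cong ∣_∣ (∩-comm y x)) (cong ∣_∣ (∩-comm y (∁ x))))))
                          (size-3-meeting-2 ∣ x ∩ y ∣ ∣ ∁ x ∩ y ∣)

module _ {n : ℕ} (g : Subset n → Bool) where

  inX₁ inX₂ : Subset n → Bool
  inX₁ x = (∣ x ∣ ≡ᵇ 3) ∧ g x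
  inX₂ x = (∣ x ∣ ≡ᵇ 3) ∧ not (g x)

  #X₁ #X₂ : ℕ
  #X₁ = #ₛ n inX₁
  #X₂ = #ₛ n inX₂

  #X₁+#X₂≡nC3 : #X₁ + #X₂ ≡ n C 3
  #X₁+#X₂≡nC3 = trans (sym (∑-distrib-+ (allSubsets n) _ _))
                      (trans (∑-cong (allSubsets n) (λ x → either-part (∣ x ∣ ≡ᵇ 3) (g x))) (#-ofSize n 3))
    where either-part : ∀ u c → 𝟙 (u ∧ c) + 𝟙 (u ∧ not c) ≡ 𝟙 u
          either-part false c     = refl
          either-part true  true  = refl
          either-part true  false = refl

  #X₁→X₂ : ℕ
  #X₁→X₂ = ∑[ x ∈ allSubsets n ] #[ y ⊆ n ∣ does (adjacent? x y) ∧ (g x ∧ not (g y)) ]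

  ∑<-∣supp∣≡#X₁→X₂ : ∑< n (λ i j → ∣supp∣ i j (partialDiff g i j)) ≡ #X₁→X₂
  ∑<-∣supp∣≡#X₁→X₂ = trans (∑<-cong (λ i j i<j → ∣supp∣-partialDiff g (<⇒≢ i<j)))
                           (trans (∑<-symmetrize (flips g) (flips-diag g))
                                  (∑-admissible≡∑-adjacent (λ x y → g x ∧ not (g y))))

  private
    coloured-nbr : Bool → Subset n → Subset n → Bool
    coloured-nbr b x y = (∣ y ∣ ≡ᵇ 3) ∧ ((∣ x ∩ y ∣ ≡ᵇ 2) ∧ does (g y ≟ᵇ b))

  #X₁→X₂≡#X₁*p₁₂ : {p₁₂ : ℕ} → (∀ x → ∣ x ∣ ≡ 3 → g x ≡ true → nbrsIn g false x ≡ p₁₂) → #X₁→X₂ ≡ #X₁ * p₁₂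
  #X₁→X₂≡#X₁*p₁₂ {p₁₂} X₁→p₁₂ = begin
    #X₁→X₂
      ≡⟨ ∑-cong (allSubsets n) (λ x → trans (∑-cong (allSubsets n) (factor x))
                                           (∑-distribˡ-* (𝟙 (inX₁ x)) (allSubsets n) (𝟙 ∘ coloured-nbr false x))) ⟩
    ∑[ x ∈ allSubsets n ] (𝟙 (inX₁ x) * #[ y ⊆ n ∣ coloured-nbr false x y ])
      ≡⟨ ∑-cong (allSubsets n) (λ x → 𝟙-*-cong (inX₁ x) λ x∈X₁ → trans (sym (nbrsIn≡# g false x))
           (X₁→p₁₂ x (does⇒ (∣ x ∣ ≟ 3) (proj₁ (∧≡true x∈X₁))) (proj₂ (∧≡true x∈X₁)))) ⟩
    ∑[ x ∈ allSubsets n ] (𝟙 (inX₁ x) * p₁₂)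
      ≡⟨ ∑-distribʳ-* p₁₂ (allSubsets n) _ ⟩
    #X₁ * p₁₂ ∎
    where
    open ≡-Reasoning
    regroup : ∀ a gx gy u v → ((a ∧ (u ∧ v)) ∧ (gx ∧ not gy)) ≡ ((a ∧ gx) ∧ (u ∧ (v ∧ does (gy ≟ᵇ false))))
    regroup false gx    gy    u v = refl
    regroup true  false gy    u v = ∧-zeroʳ _
    regroup true  true  true  u v = trans (∧-zeroʳ _) (sym (trans (cong (u ∧_) (∧-zeroʳ v)) (∧-zeroʳ u)))
    regroup true  true  false u v = trans (∧-identityʳ _) (sym (cong (u ∧_) (∧-identityʳ v)))
    factor : ∀ x y → 𝟙 (does (adjacent? x y) ∧ (g x ∧ not (g y))) ≡ 𝟙 (inX₁ x) * 𝟙 (coloured-nbr false x y)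
    factor x y = trans (cong 𝟙 (regroup (∣ x ∣ ≡ᵇ 3) (g x) (g y) (∣ y ∣ ≡ᵇ 3) (∣ x ∩ y ∣ ≡ᵇ 2)))
                       (𝟙-∧ (inX₁ x) (coloured-nbr false x y))

  #X₁→X₂≡#X₂*p₂₁ : {p₂₁ : ℕ} → (∀ x → ∣ x ∣ ≡ 3 → g x ≡ false → nbrsIn g true x ≡ p₂₁) → #X₁→X₂ ≡ #X₂ * p₂₁
  #X₁→X₂≡#X₂*p₂₁ {p₂₁} X₂→p₂₁ = begin
    #X₁→X₂
      ≡⟨ ∑-comm (allSubsets n) (allSubsets n) (λ x y → 𝟙 (does (adjacent? x y) ∧ (g x ∧ not (g y)))) ⟩
    ∑[ y ∈ allSubsets n ] ∑[ x ∈ allSubsets n ] 𝟙 (does (adjacent? x y) ∧ (g x ∧ not (g y)))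
      ≡⟨ ∑-cong (allSubsets n) (λ y → trans (∑-cong (allSubsets n) (λ x → factor x y))
                                           (∑-distribˡ-* (𝟙 (inX₂ y)) (allSubsets n) (𝟙 ∘ coloured-nbr true y))) ⟩
    ∑[ y ∈ allSubsets n ] (𝟙 (inX₂ y) * #[ x ⊆ n ∣ coloured-nbr true y x ])
      ≡⟨ ∑-cong (allSubsets n) (λ y → 𝟙-*-cong (inX₂ y) λ y∈X₂ → trans (sym (nbrsIn≡# g true y))
           (X₂→p₂₁ y (does⇒ (∣ y ∣ ≟ 3) (proj₁ (∧≡true y∈X₂))) (not-injective (proj₂ (∧≡true y∈X₂))))) ⟩
    ∑[ y ∈ allSubsets n ] (𝟙 (inX₂ y) * p₂₁)
      ≡⟨ ∑-distribʳ-* p₂₁ (allSubsets n) _ ⟩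
    #X₂ * p₂₁ ∎
    where
    open ≡-Reasoning
    regroup : ∀ a gx gy u v → ((a ∧ (u ∧ v)) ∧ (gx ∧ not gy)) ≡ ((u ∧ not gy) ∧ (a ∧ (v ∧ does (gx ≟ᵇ true))))
    regroup a gx    gy    false v = cong (_∧ (gx ∧ not gy)) (∧-zeroʳ a)
    regroup a gx    true  true  v = trans (cong ((a ∧ v) ∧_) (∧-zeroʳ gx)) (∧-zeroʳ _)
    regroup a true  false true  v = trans (∧-identityʳ _) (cong (a ∧_) (sym (∧-identityʳ v)))
    regroup a false false true  v = trans (∧-zeroʳ _) (sym (trans (cong (a ∧_) (∧-zeroʳ v)) (∧-zeroʳ a)))
    factor : ∀ x y → 𝟙 (does (adjacent? x y) ∧ (g x ∧ not (g y))) ≡ 𝟙 (inX₂ y) * 𝟙 (coloured-nbr true y x)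
    factor x y = trans (cong 𝟙 (trans (cong (λ m → ((∣ x ∣ ≡ᵇ 3) ∧ ((∣ y ∣ ≡ᵇ 3) ∧ (m ≡ᵇ 2))) ∧ (g x ∧ not (g y)))
                                             (cong ∣_∣ (∩-comm x y)))
                                       (regroup (∣ x ∣ ≡ᵇ 3) (g x) (g y) (∣ y ∣ ≡ᵇ 3) (∣ y ∩ x ∣ ≡ᵇ 2))))
                       (𝟙-∧ (inX₂ y) (coloured-nbr true y x))

m-n≡k⇒m≡n+k : ∀ m n k → ℤ.+_ m ℤ.- ℤ.+_ n ≡ ℤ.+_ k → m ≡ n + k
m-n≡k⇒m≡n+k m n k m-n≡k with n ≤? m
... | yes n≤m = trans (sym (m+[n∸m]≡n n≤m)) (cong (n +_) (ℤ.+-injective (trans (sym (ℤ.⊖-≥ n≤m)) (trans (sym (ℤ.m-n≡m⊖n m n)) m-n≡k))))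
... | no n≰m  = ⊥-elim (-[1+n]≢+k (trans (sym (ℤ.⊖-< (≰⇒> n≰m))) (trans (sym (ℤ.m-n≡m⊖n m n)) m-n≡k)))
  where -[1+n]≢+k : ℤ.- (ℤ.+_ (n ∸ m)) ≢ ℤ.+_ k
        -[1+n]≢+k with n ∸ m | m>n⇒m∸n≢0 (≰⇒> n≰m)
        ... | zero  | n∸m≢0 = ⊥-elim (n∸m≢0 refl)
        ... | suc _ | _     = λ ()

λ₂⇒p₁₂+p₂₁≡2[n∸1] : ∀ {n p₁₁ p₁₂ p₂₁} → 7 ≤ n → p₁₁ + p₁₂ ≡ 3 * (n ∸ 3) →
  ℤ.+_ p₁₁ ℤ.- ℤ.+_ p₂₁ ≡ ℤ.+_ n ℤ.- ℤ.+_ 7 → p₁₂ + p₂₁ ≡ 2 * (n ∸ 1)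
λ₂⇒p₁₂+p₂₁≡2[n∸1] {p₁₁ = p₁₁} {p₁₂} {p₂₁} (s≤s (s≤s (s≤s (s≤s (s≤s (s≤s (s≤s (z≤n {k})))))))) row-sum λ₂ =
  +-cancelʳ-≡ k (p₁₂ + p₂₁) (2 * (6 + k)) (begin
    p₁₂ + p₂₁ + k    ≡⟨ rearrange p₁₂ p₂₁ k ⟩
    p₂₁ + k + p₁₂    ≡⟨ cong (_+ p₁₂) (sym (m-n≡k⇒m≡n+k p₁₁ p₂₁ k λ₂)) ⟩
    p₁₁ + p₁₂        ≡⟨ row-sum ⟩
    3 * (4 + k)      ≡⟨ split k ⟩
    2 * (6 + k) + k  ∎)
  where
  open ≡-Reasoning
  rearrange : ∀ a b k → a + b + k ≡ b + k + a
  rearrange = solve-∀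
  split : ∀ k → 3 * (4 + k) ≡ 2 * (6 + k) + k
  split = solve-∀

double-count : ∀ {E X₁ X₂ p₁₂ p₂₁} → E ≡ X₁ * p₁₂ → E ≡ X₂ * p₂₁ → E * (p₁₂ + p₂₁) ≡ p₁₂ * p₂₁ * (X₁ + X₂)
double-count {E} {X₁} {X₂} {p₁₂} {p₂₁} E≡X₁p₁₂ E≡X₂p₂₁ = begin
  E * (p₁₂ + p₂₁)                     ≡⟨ *-distribˡ-+ E p₁₂ p₂₁ ⟩
  E * p₁₂ + E * p₂₁                   ≡⟨ cong₂ _+_ (cong (_* p₁₂) E≡X₂p₂₁) (cong (_* p₂₁) E≡X₁p₁₂) ⟩
  X₂ * p₂₁ * p₁₂ + X₁ * p₁₂ * p₂₁     ≡⟨ regroup X₁ X₂ p₁₂ p₂₁ ⟩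
  p₁₂ * p₂₁ * (X₁ + X₂)               ∎
  where
  open ≡-Reasoning
  regroup : ∀ X₁ X₂ a b → X₂ * b * a + X₁ * a * b ≡ a * b * (X₁ + X₂)
  regroup = solve-∀

-- Multiply the goal by 4(n − 1); both sides then reduce to 6 · 4E(p₁₂ + p₂₁) through the hypotheses.
λ₂-edge-identity : ∀ {n p₁₂ p₂₁ t₁ t₂ E} → 7 ≤ n → p₁₂ + p₂₁ ≡ 2 * (n ∸ 1) →
  E * (p₁₂ + p₂₁) ≡ p₁₂ * p₂₁ * (n C 3) → 4 * E ≡ 8 * (n ∸ 4) * t₁ + (n ∸ 2) * (n ∸ 4) * t₂ →
  p₁₂ * p₂₁ * n * (n ∸ 2) ≡ 24 * t₁ * (n ∸ 4) + 3 * t₂ * (n ∸ 2) * (n ∸ 4)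
λ₂-edge-identity {p₁₂ = p₁₂} {p₂₁} {t₁} {t₂} {E} (s≤s (s≤s (s≤s (s≤s (s≤s (s≤s (s≤s (z≤n {k}))))))))
                 p₁₂+p₂₁≡ E-by-rows E-by-pairs =
  *-cancelˡ-≡ _ _ (4 * (6 + k)) (begin
    4 * (6 + k) * (P * (7 + k) * (5 + k))                   ≡⟨ sol₁ P k ⟩
    4 * P * ((7 + k) * (6 + k) * (5 + k))                   ≡⟨ cong (4 * P *_) (sym (6*mC3≡m*[m∸1]*[m∸2] (7 + k))) ⟩
    4 * P * (6 * ((7 + k) C 3))                             ≡⟨ sol₂ P ((7 + k) C 3) ⟩
    6 * 4 * (P * ((7 + k) C 3))                             ≡⟨ cong (6 * 4 *_) (sym E-by-rows) ⟩
    6 * 4 * (E * (p₁₂ + p₂₁))                               ≡⟨ cong (λ s → 6 * 4 * (E * s)) p₁₂+p₂₁≡ ⟩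
    6 * 4 * (E * (2 * (6 + k)))                             ≡⟨ sol₃ E k ⟩
    6 * (2 * (6 + k)) * (4 * E)                             ≡⟨ cong (6 * (2 * (6 + k)) *_) E-by-pairs ⟩
    6 * (2 * (6 + k)) * (8 * (3 + k) * t₁ + (5 + k) * (3 + k) * t₂)  ≡⟨ sol₄ k t₁ t₂ ⟩
    4 * (6 + k) * (24 * t₁ * (3 + k) + 3 * t₂ * (5 + k) * (3 + k))   ∎)
  where
  open ≡-Reasoning
  P = p₁₂ * p₂₁
  sol₁ : ∀ P k → 4 * (6 + k) * (P * (7 + k) * (5 + k)) ≡ 4 * P * ((7 + k) * (6 + k) * (5 + k))
  sol₁ = solve-∀
  sol₂ : ∀ P N → 4 * P * (6 * N) ≡ 6 * 4 * (P * N)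
  sol₂ = solve-∀
  sol₃ : ∀ E k → 6 * 4 * (E * (2 * (6 + k))) ≡ 6 * (2 * (6 + k)) * (4 * E)
  sol₃ = solve-∀
  sol₄ : ∀ k t₁ t₂ → 6 * (2 * (6 + k)) * (8 * (3 + k) * t₁ + (5 + k) * (3 + k) * t₂)
                     ≡ 4 * (6 + k) * (24 * t₁ * (3 + k) + 3 * t₂ * (5 + k) * (3 + k))
  sol₄ = solve-∀

mainTheorem6 : (n : ℕ) → 7 ≤ n → (g : Subset n → Bool) → (p11 p12 p21 p22 : ℕ) →
    IsLambda2Equitable n g p11 p12 p21 p22 →
    (t₁ t₂ : ℕ) →
    ExactlyPairs (λ i j → IsType1 i j (partialDiff g i j)) t₁ →
    ExactlyPairs (λ i j → IsType2 i j (partialDiff g i j)) t₂ →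
    (∀ (i j : Fin n) → i < j →
       IsType1 i j (partialDiff g i j) ⊎ IsType2 i j (partialDiff g i j) ⊎ IsZeroFn i j (partialDiff g i j)) →
    p12 * p21 * n * (n ∸ 2) ≡ 24 * t₁ * (n ∸ 4) + 3 * t₂ * (n ∸ 2) * (n ∸ 4)
mainTheorem6 n 7≤n g p11 p12 p21 p22 (((x₁ , ∣x₁∣≡3 , x₁∈X₁) , _ , X₁-rows , X₂-rows) , λ₂) t₁ t₂ type₁-pairs type₂-pairs classified =
  λ₂-edge-identity {p₁₂ = p12} {p21} {E = #X₁→X₂ g} 7≤n p₁₂+p₂₁≡2[n∸1]
    (trans (double-count {X₁ = #X₁ g} {#X₂ g} (#X₁→X₂≡#X₁*p₁₂ g (λ x ∣x∣≡3 x∈X₁ → proj₂ (X₁-rows x ∣x∣≡3 x∈X₁)))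
                         (#X₁→X₂≡#X₂*p₂₁ g (λ x ∣x∣≡3 x∈X₂ → proj₁ (X₂-rows x ∣x∣≡3 x∈X₂))))
           (cong (p12 * p21 *_) (#X₁+#X₂≡nC3 g)))
    (trans (cong (4 *_) (sym (∑<-∣supp∣≡#X₁→X₂ g)))
           (4*∑<-∣supp∣ (≤-trans (n≤1+n 6) 7≤n) (partialDiff g) type₁-pairs type₂-pairs classified))
  where
  p₁₂+p₂₁≡2[n∸1] : p12 + p21 ≡ 2 * (n ∸ 1)
  p₁₂+p₂₁≡2[n∸1] = λ₂⇒p₁₂+p₂₁≡2[n∸1] {p₁₁ = p11} {p12} {p21} 7≤n
    (trans (sym (uncurry (cong₂ _+_) (X₁-rows x₁ ∣x₁∣≡3 x₁∈X₁))) (J3-regular g x₁ ∣x₁∣≡3)) λ₂
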